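{- For $m,n\geq 0$, \[ f_{\Gamma^+(m,n)}(q) = H_{m,n}(q,0) = \sum_{a\geq 0}\binom{m}{a}\binom{n}{a}q^a, \] where $H_{m,n}(q,0)$ is evaluated with the convention $0^0=1$.
   Context: Fix $m,n\geq0$, $X=\{x_1,\dots,x_m\}$, $Y=\{y_1,\dots,y_n\}$, $\mathcal E(X,Y)=\{\{x,y\}:x\in X,y\in Y\}$. The noncrossing matching complex $\Gamma(m,n)$ is the simplicial complex on $X\uplus Y\uplus\mathcal E(X,Y)$ whose faces are the sets $\sigma$ such that (i) each letter occurs at most once among the elements of $\sigma$, and (ii) if $\{x_{s_1},y_{t_1}\},\{x_{s_2},y_{t_2}\}\in\sigma$ with $s_1<s_2$ then $t_1<t_2$. $\Gamma^+(m,n)$ is the subcomplex of faces contained in $\mathcal E(X,Y)$ (no loops). For a complex $\Delta$, $f_\Delta(q)=\sum_{\sigma\in\Delta}q^{|\sigma|}$. A shuffle word is a word over $X\cup Y$ without repeated letters in which $x_i$ precedes $x_j$ and $y_i$ precedes $y_j$ whenever both occur and $i<j$; $\mathsf{Shuf}(m,n)$ is their set. The bubble lattice $\mathbf{Bub}(m,n)$ orders $\mathsf{Shuf}(m,n)$ by the reflexive–transitive closure of: (indel) delete a letter of $X$ or insert a letter of $Y$; (transposition) replace a consecutive factor $xy$ ($x\in X,y\in Y$) by $yx$. $\mathsf{in}(\mathbf u)$ is the number of lower covers of $\mathbf u$, $\mathsf{in}_{\mathrm{indel}}(\mathbf u)$ the number of those differing from $\mathbf u$ by an indel, and $H_{m,n}(q,t)=\sum_{\mathbf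 u}q^{\mathsf{in}(\mathbf u)}t^{\mathsf{in}_{\mathrm{indel}}(\mathbf u)}$. -}

module Defs where

open import Data.Nat using (ℕ; zero; suc; _+_; _<_)
open import Data.Fin using (Fin; toℕ)
open import Data.Bool using (Bool; true; false) renaming (_≟_ to _≟ᵇ_)
open import Data.Vec using (Vec; lookup; count)
open import Data.List using (List; []; _∷_; _++_; length)
open import Data.List.Membership.Propositional using (_∈_)
open import Data.List.Relation.Unary.Unique.Propositional using (Unique)
open import Data.Product using (Σ; _×_; ∃; ∃-syntax)
open import Data.Sum using (_⊎_)
open import Relation.Binary.PropositionalEquality using (_≡_; _≢_)
open import Relation.Binary.Construct.Closure.ReflexiveTransitive using (Star)
open import Relation.Nullary using (¬_)
import Data.Vec as V

Card : {A : Set} → (A → Set) → ℕ → Set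
Card {A} P N =
  Σ (List A) λ L → Unique L × length L ≡ N × (∀ a → (a ∈ L → P a) × (P a → a ∈ L))

-- The noncrossing matching complex without loops, Γ⁺(m,n).
-- A set of edges σ ⊆ E(X,Y) is encoded by its indicator matrix:
-- σ[i][j] ≡ true  iff  {x_(i+1), y_(j+1)} ∈ σ.

EdgeSet : ℕ → ℕ → Set
EdgeSet m n = Vec (Vec Bool n) m

_∋ₑ_ : ∀ {m n} → EdgeSet m n → Fin m × Fin n → Set
σ ∋ₑ (i Data.Product., j) = lookup (lookup σ i) j ≡ true

size : ∀ {m n} → EdgeSet m n → ℕ
size V.[] = 0
size (r V.∷ σ) = count (λ b → b ≟ᵇ true) r + size σ

IsFaceΓ⁺ : ∀ {m n} → EdgeSet m n → Set
IsFaceΓ⁺ {m} {n} σ =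
  (∀ i j j' → σ ∋ₑ (i Data.Product., j) → σ ∋ₑ (i Data.Product., j') → j ≡ j')
  × (∀ i i' j → σ ∋ₑ (i Data.Product., j) → σ ∋ₑ (i' Data.Product., j) → i ≡ i')
  × (∀ s₁ t₁ s₂ t₂ → σ ∋ₑ (s₁ Data.Product., t₁) → σ ∋ₑ (s₂ Data.Product., t₂)
       → toℕ s₁ < toℕ s₂ → toℕ t₁ < toℕ t₂)

data Letter (m n : ℕ) : Set where
  x : Fin m → Letter m n
  y : Fin n → Letter m n

Word : ℕ → ℕ → Set
Word m n = List (Letter m n)

IsShuffle : ∀ {m n} → Word m n → Set
IsShuffle {m} {n} u =
  Unique u
  × (∀ (p q s : Word m n) (i j : Fin m) → u ≡ p ++ x i ∷ q ++ x j ∷ s → toℕ i < toℕ j)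
  × (∀ (p q s : Word m n) (i j : Fin n) → u ≡ p ++ y i ∷ q ++ y j ∷ s → toℕ i < toℕ j)

data Move {m n : ℕ} : Word m n → Word m n → Set where
  del  : ∀ p s i   → Move (p ++ x i ∷ s) (p ++ s)
  ins  : ∀ p s j   → Move (p ++ s) (p ++ y j ∷ s)
  swap : ∀ p s i j → Move (p ++ x i ∷ y j ∷ s) (p ++ y j ∷ x i ∷ s)

ShufMove : ∀ {m n} → Word m n → Word m n → Set
ShufMove u v = IsShuffle u × IsShuffle v × Move u v

_≤Bub_ : ∀ {m n} → Word m n → Word m n → Set
u ≤Bub v = Star ShufMove u v

_⋖_ : ∀ {m n} → Word m n → Word m n → Set
v ⋖ u = IsShuffle v × IsShuffle u × v ≤Bub u × v ≢ u
        × (∀ w → v ≤Bub w → w ≤Bub u → (w ≡ v) ⊎ (w ≡ u))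

IndelDiff : ∀ {m n} → Word m n → Word m n → Set
IndelDiff {m} {n} a b =
  Σ (Word m n) λ p → Σ (Word m n) λ s → Σ (Letter m n) λ ℓ →
    ((a ≡ p ++ s × b ≡ p ++ ℓ ∷ s) ⊎ (b ≡ p ++ s × a ≡ p ++ ℓ ∷ s))

InDeg : ∀ {m n} → Word m n → ℕ → Set
InDeg u k = Card (λ v → v ⋖ u) k

InDegIndel : ∀ {m n} → Word m n → ℕ → Set
InDegIndel u k = Card (λ v → v ⋖ u × IndelDiff v u) k

-- A face of Γ⁺(m,n) of size a is a noncrossing matching of a of the x's with a of the y's.
-- A shuffle word has no lower cover by an indel exactly when it contains every x and each
-- of its y's is immediately followed by an x; its lower covers are then the swaps of its
-- factors y x, so in(u) is its number of y's.  Both families obey the recurrence of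
-- C(m,a)·C(n,a) obtained by asking whether x₁ is matched (in a word: preceded by a y) and, if
-- so, whether to y₁.  To recognise covers, the number of inversions (a y left of an x) serves
-- as a potential along paths of the bubble order: each swap raises it by exactly one.
module Submission where

open import Defs
open import Data.Nat using (ℕ; zero; suc; _+_; _*_; _≤_; _<_; z≤n; s≤s; s≤s⁻¹)
open import Data.Nat.Properties
open import Algebra.Properties.CommutativeSemigroup +-commutativeSemigroup using (x∙yz≈y∙xz)
open import Data.Nat.Combinatorics using (_C_; nCk+nC[k+1]≡[n+1]C[k+1])
open import Data.Bool using (Bool; true; false) renaming (_≟_ to _≟ᵇ_)
open import Data.Fin as Fin using (Fin; zero; suc; toℕ)
import Data.Fin.Properties as Finₚ
open import Data.Vec as Vec using (Vec; []; _∷_; lookup; replicate; count)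
import Data.Vec.Properties as Vecₚ
open import Data.List as List using (List; []; _∷_; _++_; length; map; [_])
open import Data.List.Properties
  using (length-++; length-map; ++-assoc; ++-identityʳ; map-injective; ∷-injectiveʳ)
open import Data.List.Membership.Propositional using (_∈_; _∉_)
open import Data.List.Membership.Propositional.Properties
open import Data.List.Membership.Propositional.Properties.WithK using (unique∧set⇒bag)
open import Data.List.Relation.Binary.BagAndSetEquality using (_∼[_]_; set; ∼bag⇒↭)
open import Data.List.Relation.Binary.Permutation.Propositional.Properties using (↭-length)
open import Data.List.Relation.Unary.Any using (here; there; any?)
open import Data.List.Relation.Unary.All as All using (All; []; _∷_)
open import Data.List.Relation.Unary.AllPairs as AllPairs using (AllPairs; []; _∷_)
import Data.List.Relation.Unary.AllPairs.Properties as AllPairsₚ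
open import Data.List.Relation.Unary.Unique.Propositional using (Unique)
import Data.List.Relation.Unary.Unique.Propositional.Properties as Uniqueₚ
open import Data.Product using (_×_; _,_; proj₁; proj₂; ∃)
open import Data.Sum as Sum using (_⊎_; inj₁; inj₂)
open import Data.Empty using (⊥; ⊥-elim)
open import Data.Unit using (⊤; tt)
open import Function.Base using (case_of_)
open import Function.Bundles using (_⇔_; mk⇔; Equivalence)
open import Function.Definitions using (Injective)
open import Relation.Binary.Construct.Closure.ReflexiveTransitive using (ε; _◅_; _◅◅_)
open import Relation.Binary.Definitions using (tri<; tri≈; tri>)
open import Relation.Binary.PropositionalEquality hiding ([_])
open import Relation.Nullary using (¬_; Dec; yes; no)

private
  variable
    m n m' n' a : ℕ

module _ {A : Set} {P Q : A → Set} where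

  Card-resp : ∀ {N} → (∀ a → P a → Q a) → (∀ a → Q a → P a) → Card P N → Card Q N
  Card-resp to from (L , u , l , h) =
    L , u , l , λ a → (λ a∈L → to a (proj₁ (h a) a∈L)) , (λ q → proj₂ (h a) (from a q))

  Card-⊎ : ∀ {N M} → (∀ a → P a → Q a → ⊥) → Card P N → Card Q M →
           Card (λ a → P a ⊎ Q a) (N + M)
  Card-⊎ disjoint (L , u , l , h) (L' , u' , l' , h') =
    L ++ L' ,
    Uniqueₚ.++⁺ u u' (λ {a} (a∈L , a∈L') → disjoint a (proj₁ (h a) a∈L) (proj₁ (h' a) a∈L')) ,
    trans (length-++ L) (cong₂ _+_ l l') ,
    λ a → (λ a∈LL' → Sum.map (proj₁ (h a)) (proj₁ (h' a)) (∈-++⁻ L a∈LL')) ,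
          Sum.[ (λ p → ∈-++⁺ˡ (proj₂ (h a) p)) , (λ q → ∈-++⁺ʳ L (proj₂ (h' a) q)) ]

Image : {A B : Set} → (A → B) → (A → Set) → B → Set
Image f P b = ∃ λ a → P a × f a ≡ b

module _ {A : Set} {P : A → Set} where

  Card-∅ : (∀ a → ¬ P a) → Card P 0
  Card-∅ ¬P = [] , [] , refl , λ a → (λ ()) , λ p → ⊥-elim (¬P a p)

  Card-0⇒∅ : Card P 0 → ∀ a → ¬ P a
  Card-0⇒∅ ([] , _ , _ , h) a p = case proj₂ (h a) p of λ ()

  Card-singleton : ∀ a₀ → P a₀ → (∀ a → P a → a ≡ a₀) → Card P 1
  Card-singleton a₀ p only =
    a₀ ∷ [] , [] ∷ [] , refl , λ a → (λ { (here refl) → p }) , λ q → here (only a q)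

  Card-image : ∀ {B : Set} {N} (f : A → B) → Injective _≡_ _≡_ f → Card P N → Card (Image f P) N
  Card-image f f-inj (L , u , l , h) =
    map f L , Uniqueₚ.map⁺ f-inj u , trans (length-map f L) l ,
    λ b → (λ b∈fL → let a , a∈L , b≡fa = ∈-map⁻ f b∈fL in a , proj₁ (h a) a∈L , sym b≡fa) ,
          λ { (a , p , refl) → ∈-map⁺ f (proj₂ (h a) p) }

  Card-unique : ∀ {N N'} → Card P N → Card P N' → N ≡ N'
  Card-unique (L , u , l , h) (L' , u' , l' , h') =
    trans (sym l) (trans (↭-length (∼bag⇒↭ (unique∧set⇒bag u u' same-members))) l')
    where
    same-members : L ∼[ set ] L'
    same-members {a} = mk⇔ (λ a∈L → proj₂ (h' a) (proj₁ (h a) a∈L))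
                           (λ a∈L' → proj₂ (h a) (proj₁ (h' a) a∈L'))

pascal-*ʳ : ∀ m a k → (m C a) * k + (m C suc a) * k ≡ (suc m C suc a) * k
pascal-*ʳ m a k =
  trans (sym (*-distribʳ-+ k (m C a) (m C suc a))) (cong (_* k) (nCk+nC[k+1]≡[n+1]C[k+1] m a))

pascal-*ˡ : ∀ k n a → k * (n C a) + k * (n C suc a) ≡ k * (suc n C suc a)
pascal-*ˡ k n a =
  trans (sym (*-distribˡ-+ k (n C a) (n C suc a))) (cong (k *_) (nCk+nC[k+1]≡[n+1]C[k+1] n a))

-- Objects on x₁ … x_m and y₁ … y_n, graded by a size.  An object on x₁ … x_(m+1) either
-- leaves x₁ free or matches it, and in the latter case x₁ is matched with y₁ or y₁ is free.
record CountingScheme (Obj : ℕ → ℕ → Set) : Set₁ where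
  field
    Counted      : ℕ → Obj m n → Set
    FirstMatched : Obj (suc m) n → Set
    addFreeX     : Obj m n → Obj (suc m) n
    addPair      : Obj m n → Obj (suc m) (suc n)
    addFreeY     : Obj (suc m) n → Obj (suc m) (suc n)
    addFreeX-injective : Injective _≡_ _≡_ (addFreeX {m} {n})
    addPair-injective  : Injective _≡_ _≡_ (addPair {m} {n})
    addFreeY-injective : Injective _≡_ _≡_ (addFreeY {m} {n})
    addFreeX-counted   : {c : Obj m n} → Counted a c → Counted a (addFreeX c)
    addPair-counted    : {c : Obj m n} → Counted a c → Counted (suc a) (addPair c)
    addFreeY-counted   : {c : Obj (suc m) n} → Counted a c → Counted a (addFreeY c)
    addFreeX-unmatched : (c : Obj m n) → ¬ FirstMatched (addFreeX c)
    addPair-matched    : (c : Obj m n) → FirstMatched (addPair c)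
    addFreeY-matched   : {c : Obj (suc m) n} → FirstMatched c → FirstMatched (addFreeY c)
    addPair≢addFreeY   : (c : Obj m n) (c' : Obj (suc m) n) → addPair c ≢ addFreeY c'
    counted-split : {c : Obj (suc m) n} → Counted a c →
                    FirstMatched c ⊎ Image addFreeX (Counted a) c
    matched-split : {c : Obj (suc m) (suc n)} → Counted (suc a) c → FirstMatched c →
                    Image addPair (Counted a) c
                    ⊎ Image addFreeY (λ c' → Counted (suc a) c' × FirstMatched c') c
    counted-empty     : Card (Counted {0} {n} 0) 1
    counted-empty-suc : (c : Obj 0 n) → ¬ Counted (suc a) c
    matched-size-zero : {c : Obj (suc m) n} → Counted 0 c → ¬ FirstMatched c
    matched-noY       : (c : Obj (suc m) 0) → ¬ FirstMatched c

  CountedMatched : ℕ → Obj (suc m) n → Set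
  CountedMatched a c = Counted a c × FirstMatched c

module CountingSchemeCard {Obj : ℕ → ℕ → Set} (S : CountingScheme Obj) where
  open CountingScheme S

  counted-card : ∀ m n a → Card (Counted {m} {n} a) ((m C a) * (n C a))
  matched-card : ∀ m n a → Card (CountedMatched {m} {n} (suc a)) ((m C a) * (n C suc a))

  counted-card zero n zero = counted-empty
  counted-card zero n (suc a) = Card-∅ counted-empty-suc
  counted-card (suc m) n zero =
    Card-resp to from (Card-image addFreeX addFreeX-injective (counted-card m n zero))
    where
    to : ∀ c → Image addFreeX (Counted 0) c → Counted 0 c
    to _ (_ , k , refl) = addFreeX-counted k
    from : ∀ c → Counted 0 c → Image addFreeX (Counted 0) c
    from c k = Sum.[ (λ fm → ⊥-elim (matched-size-zero k fm)) , (λ free → free) ] (counted-split k)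
  counted-card (suc m) n (suc a) =
    subst (Card _) (pascal-*ʳ m a (n C suc a))
      (Card-resp to from
        (Card-⊎ disjoint (matched-card m n a)
                         (Card-image addFreeX addFreeX-injective (counted-card m n (suc a)))))
    where
    disjoint : ∀ c → CountedMatched (suc a) c → Image addFreeX (Counted (suc a)) c → ⊥
    disjoint _ (_ , fm) (c' , _ , refl) = addFreeX-unmatched c' fm
    to : ∀ c → CountedMatched (suc a) c ⊎ Image addFreeX (Counted (suc a)) c → Counted (suc a) c
    to _ (inj₁ (k , _)) = k
    to _ (inj₂ (_ , k , refl)) = addFreeX-counted k
    from : ∀ c → Counted (suc a) c → CountedMatched (suc a) c ⊎ Image addFreeX (Counted (suc a)) c
    from c k = Sum.map₁ (k ,_) (counted-split k)

  matched-card m zero a =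
    subst (Card _) (sym (*-zeroʳ (m C a))) (Card-∅ λ c (_ , fm) → matched-noY c fm)
  matched-card m (suc n) a =
    subst (Card _) (pascal-*ˡ (m C a) n a)
      (Card-resp to (λ _ (k , fm) → matched-split k fm)
        (Card-⊎ disjoint (Card-image addPair addPair-injective (counted-card m n a))
                         (Card-image addFreeY addFreeY-injective (matched-card m n a))))
    where
    disjoint : ∀ c → Image addPair (Counted a) c → Image addFreeY (CountedMatched (suc a)) c → ⊥
    disjoint _ (c , _ , refl) (c' , _ , e) = addPair≢addFreeY c c' (sym e)
    to : ∀ c → Image addPair (Counted a) c ⊎ Image addFreeY (CountedMatched (suc a)) c →
         CountedMatched (suc a) c
    to _ (inj₁ (c , k , refl)) = addPair-counted k , addPair-matched c
    to _ (inj₂ (_ , (k , fm) , refl)) = addFreeY-counted k , addFreeY-matched fm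

record OrderEmbedding (k k' : ℕ) : Set where
  field
    embed           : Fin k → Fin k'
    embed-injective : Injective _≡_ _≡_ embed
    embed-monotone  : ∀ {i i'} → toℕ i < toℕ i' → toℕ (embed i) < toℕ (embed i')
    embed-reflects  : ∀ {i i'} → toℕ (embed i) < toℕ (embed i') → toℕ i < toℕ i'

open OrderEmbedding

idEmbedding : OrderEmbedding n n
idEmbedding = record
  { embed = λ i → i ; embed-injective = λ e → e ; embed-monotone = λ p → p ; embed-reflects = λ p → p }

sucEmbedding : OrderEmbedding n (suc n)
sucEmbedding = record
  { embed = suc ; embed-injective = Finₚ.suc-injective ; embed-monotone = s≤s ; embed-reflects = s≤s⁻¹ }

-- Faces of Γ⁺(m,n)

entry : EdgeSet m n → Fin m → Fin n → Bool
entry σ i j = lookup (lookup σ i) j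

Face : ℕ → EdgeSet m n → Set
Face a σ = IsFaceΓ⁺ σ × size σ ≡ a

module FaceTransfer {ρ : EdgeSet m n} {τ : EdgeSet m' n'}
  (r : OrderEmbedding m' m) (c : OrderEmbedding n' n)
  (entry-≡ : ∀ i j → entry τ i j ≡ entry ρ (embed r i) (embed c j)) where

  private
    to : ∀ {i j} → entry τ i j ≡ true → entry ρ (embed r i) (embed c j) ≡ true
    to {i} {j} e = trans (sym (entry-≡ i j)) e

    from : ∀ {i j} → entry ρ (embed r i) (embed c j) ≡ true → entry τ i j ≡ true
    from {i} {j} e = trans (entry-≡ i j) e

  restrict : IsFaceΓ⁺ ρ → IsFaceΓ⁺ τ
  restrict (one-per-row , one-per-column , noncrossing) =
    (λ i j j' e e' → embed-injective c (one-per-row _ _ _ (to e) (to e'))) ,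
    (λ i i' j e e' → embed-injective r (one-per-column _ _ _ (to e) (to e'))) ,
    (λ s t s' t' e e' s<s' →
       embed-reflects c (noncrossing _ _ _ _ (to e) (to e') (embed-monotone r s<s')))

  extend : (∀ i₀ j₀ → entry ρ i₀ j₀ ≡ true → ∃ λ i → ∃ λ j → embed r i ≡ i₀ × embed c j ≡ j₀) →
           IsFaceΓ⁺ τ → IsFaceΓ⁺ ρ
  extend covered (one-per-row , one-per-column , noncrossing) =
    one-per-row′ , one-per-column′ , noncrossing′
    where
    one-per-row′ : ∀ i₀ j₀ j₀' → entry ρ i₀ j₀ ≡ true → entry ρ i₀ j₀' ≡ true → j₀ ≡ j₀'
    one-per-row′ i₀ j₀ j₀' e e' with covered i₀ j₀ e | covered i₀ j₀' e'
    ... | i , j , refl , refl | i' , j' , ri'≡ri , refl with embed-injective r ri'≡ri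
    ... | refl = cong (embed c) (one-per-row i j j' (from e) (from e'))
    one-per-column′ : ∀ i₀ i₀' j₀ → entry ρ i₀ j₀ ≡ true → entry ρ i₀' j₀ ≡ true → i₀ ≡ i₀'
    one-per-column′ i₀ i₀' j₀ e e' with covered i₀ j₀ e | covered i₀' j₀ e'
    ... | i , j , refl , refl | i' , j' , refl , cj'≡cj with embed-injective c cj'≡cj
    ... | refl = cong (embed r) (one-per-column i i' j (from e) (from e'))
    noncrossing′ : ∀ s₀ t₀ s₀' t₀' → entry ρ s₀ t₀ ≡ true → entry ρ s₀' t₀' ≡ true →
                   toℕ s₀ < toℕ s₀' → toℕ t₀ < toℕ t₀'
    noncrossing′ s₀ t₀ s₀' t₀' e e' s<s' with covered s₀ t₀ e | covered s₀' t₀' e'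
    ... | s , t , refl , refl | s' , t' , refl , refl =
      embed-monotone c (noncrossing s t s' t' (from e) (from e') (embed-reflects r s<s'))

emptyRow : ∀ n → Vec Bool n
emptyRow n = replicate n false

Nonempty : Vec Bool n → Set
Nonempty r = ∃ λ j → lookup r j ≡ true

emptyRow-empty : (j : Fin n) → lookup (emptyRow n) j ≢ true
emptyRow-empty zero ()
emptyRow-empty (suc j) = emptyRow-empty j

emptyRow-unique : (r : Vec Bool n) → (∀ j → lookup r j ≢ true) → r ≡ emptyRow n
emptyRow-unique [] _ = refl
emptyRow-unique (true ∷ r) empty = ⊥-elim (empty zero refl)
emptyRow-unique (false ∷ r) empty = cong (false ∷_) (emptyRow-unique r (λ j → empty (suc j)))

emptyRow-or-nonempty : (r : Vec Bool n) → r ≡ emptyRow n ⊎ Nonempty r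
emptyRow-or-nonempty [] = inj₁ refl
emptyRow-or-nonempty (true ∷ r) = inj₂ (zero , refl)
emptyRow-or-nonempty (false ∷ r) =
  Sum.map (cong (false ∷_)) (λ (j , e) → suc j , e) (emptyRow-or-nonempty r)

count-emptyRow : ∀ n → count (λ b → b ≟ᵇ true) (emptyRow n) ≡ 0
count-emptyRow zero = refl
count-emptyRow (suc n) = count-emptyRow n

count-nonempty : (r : Vec Bool n) → Nonempty r → 0 < count (λ b → b ≟ᵇ true) r
count-nonempty (true ∷ r) _ = s≤s z≤n
count-nonempty (false ∷ r) (suc j , e) = count-nonempty r (j , e)

addEmptyColumn : EdgeSet m n → EdgeSet m (suc n)
addEmptyColumn [] = []
addEmptyColumn (r ∷ σ) = (false ∷ r) ∷ addEmptyColumn σ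

dropFirstColumn : EdgeSet m (suc n) → EdgeSet m n
dropFirstColumn [] = []
dropFirstColumn (r ∷ σ) = Vec.tail r ∷ dropFirstColumn σ

dropFirstColumn-addEmptyColumn : (σ : EdgeSet m n) → dropFirstColumn (addEmptyColumn σ) ≡ σ
dropFirstColumn-addEmptyColumn [] = refl
dropFirstColumn-addEmptyColumn (r ∷ σ) = cong (r ∷_) (dropFirstColumn-addEmptyColumn σ)

addEmptyColumn-injective : Injective _≡_ _≡_ (addEmptyColumn {m} {n})
addEmptyColumn-injective {x = σ} {σ'} e =
  trans (sym (dropFirstColumn-addEmptyColumn σ))
        (trans (cong dropFirstColumn e) (dropFirstColumn-addEmptyColumn σ'))

addEmptyColumn-dropFirstColumn : (σ : EdgeSet m (suc n)) → (∀ i → entry σ i zero ≢ true) →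
                                 addEmptyColumn (dropFirstColumn σ) ≡ σ
addEmptyColumn-dropFirstColumn [] _ = refl
addEmptyColumn-dropFirstColumn ((true ∷ r) ∷ σ) empty = ⊥-elim (empty zero refl)
addEmptyColumn-dropFirstColumn ((false ∷ r) ∷ σ) empty =
  cong ((false ∷ r) ∷_) (addEmptyColumn-dropFirstColumn σ (λ i → empty (suc i)))

entry-addEmptyColumn-suc : (σ : EdgeSet m n) (i : Fin m) (j : Fin n) →
                           entry (addEmptyColumn σ) i (suc j) ≡ entry σ i j
entry-addEmptyColumn-suc (r ∷ σ) zero j = refl
entry-addEmptyColumn-suc (r ∷ σ) (suc i) j = entry-addEmptyColumn-suc σ i j

addEmptyColumn-zero-empty : (σ : EdgeSet m n) (i : Fin m) → entry (addEmptyColumn σ) i zero ≢ true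
addEmptyColumn-zero-empty (r ∷ σ) zero ()
addEmptyColumn-zero-empty (r ∷ σ) (suc i) = addEmptyColumn-zero-empty σ i

size-emptyRow∷ : (σ : EdgeSet m n) → size (emptyRow n ∷ σ) ≡ size σ
size-emptyRow∷ {n = n} σ = cong (_+ size σ) (count-emptyRow n)

size-addEmptyColumn : (σ : EdgeSet m n) → size (addEmptyColumn σ) ≡ size σ
size-addEmptyColumn [] = refl
size-addEmptyColumn (r ∷ σ) = cong (_ +_) (size-addEmptyColumn σ)

module EmptyRowTransfer {m n} (σ : EdgeSet m n) =
  FaceTransfer {ρ = emptyRow n ∷ σ} {τ = σ} sucEmbedding idEmbedding (λ i j → refl)

module AddEmptyColumnTransfer {m n} (σ : EdgeSet m n) =
  FaceTransfer {ρ = addEmptyColumn σ} {τ = σ} idEmbedding sucEmbedding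
    (λ i j → sym (entry-addEmptyColumn-suc σ i j))

emptyRow∷-face : {σ : EdgeSet m n} → Face a σ → Face a (emptyRow n ∷ σ)
emptyRow∷-face {σ = σ} (f , s) =
  EmptyRowTransfer.extend σ covered f , trans (size-emptyRow∷ σ) s
  where
  covered : ∀ i₀ j₀ → entry (emptyRow _ ∷ σ) i₀ j₀ ≡ true →
            ∃ λ i → ∃ λ j → suc i ≡ i₀ × j ≡ j₀
  covered zero j₀ e = ⊥-elim (emptyRow-empty j₀ e)
  covered (suc i) j₀ e = i , j₀ , refl , refl

emptyRow∷-face⁻ : {σ : EdgeSet m n} → Face a (emptyRow n ∷ σ) → Face a σ
emptyRow∷-face⁻ {σ = σ} (f , s) = EmptyRowTransfer.restrict σ f , trans (sym (size-emptyRow∷ σ)) s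

addEmptyColumn-isFace : (σ : EdgeSet m n) → IsFaceΓ⁺ σ → IsFaceΓ⁺ (addEmptyColumn σ)
addEmptyColumn-isFace σ = AddEmptyColumnTransfer.extend σ covered
  where
  covered : ∀ i₀ j₀ → entry (addEmptyColumn σ) i₀ j₀ ≡ true →
            ∃ λ i → ∃ λ j → i ≡ i₀ × suc j ≡ j₀
  covered i₀ zero e = ⊥-elim (addEmptyColumn-zero-empty σ i₀ e)
  covered i₀ (suc j) e = i₀ , j , refl , refl

addEmptyColumn-face : {σ : EdgeSet m n} → Face a σ → Face a (addEmptyColumn σ)
addEmptyColumn-face {σ = σ} (f , s) = addEmptyColumn-isFace σ f , trans (size-addEmptyColumn σ) s

addEmptyColumn-face⁻ : {σ : EdgeSet m n} → Face a (addEmptyColumn σ) → Face a σ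
addEmptyColumn-face⁻ {σ = σ} (f , s) =
  AddEmptyColumnTransfer.restrict σ f , trans (sym (size-addEmptyColumn σ)) s

corner : EdgeSet m n → EdgeSet (suc m) (suc n)
corner {n = n} σ = (true ∷ emptyRow n) ∷ addEmptyColumn σ

size-corner : (σ : EdgeSet m n) → size (corner σ) ≡ suc (size σ)
size-corner {n = n} σ = cong₂ (λ k l → suc (k + l)) (count-emptyRow n) (size-addEmptyColumn σ)

corner-isFace : (σ : EdgeSet m n) → IsFaceΓ⁺ σ → IsFaceΓ⁺ (corner σ)
corner-isFace σ f = one-per-row , one-per-column , noncrossing
  where
  f′ : IsFaceΓ⁺ (addEmptyColumn σ)
  f′ = addEmptyColumn-isFace σ f
  one-per-row : ∀ i j j' → entry (corner σ) i j ≡ true → entry (corner σ) i j' ≡ true → j ≡ j'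
  one-per-row zero zero zero e e' = refl
  one-per-row zero zero (suc j') e e' = ⊥-elim (emptyRow-empty j' e')
  one-per-row zero (suc j) j' e e' = ⊥-elim (emptyRow-empty j e)
  one-per-row (suc i) j j' e e' = proj₁ f′ i j j' e e'
  one-per-column : ∀ i i' j → entry (corner σ) i j ≡ true → entry (corner σ) i' j ≡ true → i ≡ i'
  one-per-column zero zero j e e' = refl
  one-per-column zero (suc i') zero e e' = ⊥-elim (addEmptyColumn-zero-empty σ i' e')
  one-per-column zero (suc i') (suc j) e e' = ⊥-elim (emptyRow-empty j e)
  one-per-column (suc i) zero zero e e' = ⊥-elim (addEmptyColumn-zero-empty σ i e)
  one-per-column (suc i) zero (suc j) e e' = ⊥-elim (emptyRow-empty j e')
  one-per-column (suc i) (suc i') j e e' = cong suc (proj₁ (proj₂ f′) i i' j e e')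
  noncrossing : ∀ s t s' t' → entry (corner σ) s t ≡ true → entry (corner σ) s' t' ≡ true →
                toℕ s < toℕ s' → toℕ t < toℕ t'
  noncrossing zero (suc t) s' t' e e' s<s' = ⊥-elim (emptyRow-empty t e)
  noncrossing zero zero (suc s') zero e e' s<s' = ⊥-elim (addEmptyColumn-zero-empty σ s' e')
  noncrossing zero zero (suc s') (suc t') e e' s<s' = s≤s z≤n
  noncrossing (suc s) t (suc s') t' e e' (s≤s s<s') = proj₂ (proj₂ f′) s t s' t' e e' s<s'

corner-isFace⁻ : (σ : EdgeSet m n) → IsFaceΓ⁺ (corner σ) → IsFaceΓ⁺ σ
corner-isFace⁻ σ (one-per-row , one-per-column , noncrossing) =
  AddEmptyColumnTransfer.restrict σ
    ((λ i → one-per-row (suc i)) ,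
     (λ i i' j e e' → Finₚ.suc-injective (one-per-column (suc i) (suc i') j e e')) ,
     (λ s t s' t' e e' s<s' → noncrossing (suc s) t (suc s') t' e e' (s≤s s<s')))

corner-face : {σ : EdgeSet m n} → Face a σ → Face (suc a) (corner σ)
corner-face {σ = σ} (f , s) = corner-isFace σ f , trans (size-corner σ) (cong suc s)

corner-face⁻ : {σ : EdgeSet m n} → Face (suc a) (corner σ) → Face a σ
corner-face⁻ {σ = σ} (f , s) = corner-isFace⁻ σ f , suc-injective (trans (sym (size-corner σ)) s)

FirstRowUsed : EdgeSet (suc m) n → Set
FirstRowUsed σ = Nonempty (Vec.head σ)

face-split : {σ : EdgeSet (suc m) n} → Face a σ → FirstRowUsed σ ⊎ Image (emptyRow n ∷_) (Face a) σ
face-split {σ = r ∷ σ} f with emptyRow-or-nonempty r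
... | inj₁ refl = inj₂ (σ , emptyRow∷-face⁻ f , refl)
... | inj₂ used = inj₁ used

firstRowUsed-split : {σ : EdgeSet (suc m) (suc n)} → Face (suc a) σ → FirstRowUsed σ →
                     Image corner (Face a) σ
                     ⊎ Image addEmptyColumn (λ τ → Face (suc a) τ × FirstRowUsed τ) σ
firstRowUsed-split {n = n} {σ = (true ∷ r) ∷ σ} f@((one-per-row , one-per-column , _) , _) _ =
  inj₁ (dropFirstColumn σ , corner-face⁻ (subst (Face _) (sym corner≡) f) , corner≡)
  where
  r-empty : r ≡ emptyRow n
  r-empty = emptyRow-unique r (λ j e → case one-per-row zero zero (suc j) refl e of λ ())
  σ-columnFree : addEmptyColumn (dropFirstColumn σ) ≡ σ
  σ-columnFree = addEmptyColumn-dropFirstColumn σ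
    (λ i e → case one-per-column zero (suc i) zero refl e of λ ())
  corner≡ : corner (dropFirstColumn σ) ≡ (true ∷ r) ∷ σ
  corner≡ = cong₂ (λ r σ → (true ∷ r) ∷ σ) (sym r-empty) σ-columnFree
firstRowUsed-split {σ = (false ∷ r) ∷ σ} f@((_ , _ , noncrossing) , _) (suc j , e) =
  inj₂ (r ∷ dropFirstColumn σ ,
        (addEmptyColumn-face⁻ (subst (Face _) (sym addEmptyColumn≡) f) , (j , e)) ,
        addEmptyColumn≡)
  where
  -- an edge {x_(i+2), y₁} would cross the edge {x₁, y_(j+2)}
  σ-columnFree : addEmptyColumn (dropFirstColumn σ) ≡ σ
  σ-columnFree = addEmptyColumn-dropFirstColumn σ
    (λ i e' → n≮0 (noncrossing zero (suc j) (suc i) zero e e' (s≤s z≤n)))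
  addEmptyColumn≡ : addEmptyColumn (r ∷ dropFirstColumn σ) ≡ (false ∷ r) ∷ σ
  addEmptyColumn≡ = cong ((false ∷ r) ∷_) σ-columnFree

faceScheme : CountingScheme EdgeSet
faceScheme = record
  { Counted = Face
  ; FirstMatched = FirstRowUsed
  ; addFreeX = emptyRow _ ∷_
  ; addPair = corner
  ; addFreeY = addEmptyColumn
  ; addFreeX-injective = Vecₚ.∷-injectiveʳ
  ; addPair-injective = λ e → addEmptyColumn-injective (Vecₚ.∷-injectiveʳ e)
  ; addFreeY-injective = addEmptyColumn-injective
  ; addFreeX-counted = emptyRow∷-face
  ; addPair-counted = corner-face
  ; addFreeY-counted = λ {c = c} → addEmptyColumn-face {σ = c}
  ; addFreeX-unmatched = λ _ (j , e) → emptyRow-empty j e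
  ; addPair-matched = λ _ → zero , refl
  ; addFreeY-matched = λ { {c = _ ∷ _} (j , e) → suc j , e }
  ; addPair≢addFreeY = λ { _ (_ ∷ _) () }
  ; counted-split = face-split
  ; matched-split = firstRowUsed-split
  ; counted-empty = Card-singleton [] (((λ ()) , (λ ()) , (λ ())) , refl) (λ { [] _ → refl })
  ; counted-empty-suc = λ { [] (_ , ()) }
  ; matched-size-zero = λ { {c = r ∷ σ} (_ , size≡0) used →
      n≮0 (≤-trans (count-nonempty r used) (≤-trans (m≤m+n _ (size σ)) (≤-reflexive size≡0))) }
  ; matched-noY = λ { _ (() , _) }
  }

module _ {A : Set} where

  ∈-insert⁺ : ∀ (p s : List A) {z} l → z ∈ p ++ s → z ∈ p ++ l ∷ s
  ∈-insert⁺ p s l z∈ with ∈-++⁻ p z∈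
  ... | inj₁ z∈p = ∈-++⁺ˡ z∈p
  ... | inj₂ z∈s = ∈-++⁺ʳ p (there z∈s)

  ∈-insert⁻ : ∀ (p s : List A) {z} l → z ∈ p ++ l ∷ s → z ≢ l → z ∈ p ++ s
  ∈-insert⁻ p s l z∈ z≢l with ∈-++⁻ p z∈
  ... | inj₁ z∈p = ∈-++⁺ˡ z∈p
  ... | inj₂ (here z≡l) = ⊥-elim (z≢l z≡l)
  ... | inj₂ (there z∈s) = ∈-++⁺ʳ p z∈s

  ∈-swap : ∀ (p s : List A) {z} l l' → z ∈ p ++ l ∷ l' ∷ s → z ∈ p ++ l' ∷ l ∷ s
  ∈-swap p s l l' z∈ with ∈-++⁻ p z∈
  ... | inj₁ z∈p = ∈-++⁺ˡ z∈p
  ... | inj₂ (here z≡l) = ∈-++⁺ʳ p (there (here z≡l))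
  ... | inj₂ (there (here z≡l')) = ∈-++⁺ʳ p (here z≡l')
  ... | inj₂ (there (there z∈s)) = ∈-++⁺ʳ p (there (there z∈s))

  ∈-middle⁻ : ∀ (p s : List A) {z} l → z ∈ p ++ l ∷ s → z ∈ p ⊎ z ≡ l ⊎ z ∈ s
  ∈-middle⁻ p s l z∈ with ∈-++⁻ p z∈
  ... | inj₁ z∈p = inj₁ z∈p
  ... | inj₂ (here z≡l) = inj₂ (inj₁ z≡l)
  ... | inj₂ (there z∈s) = inj₂ (inj₂ z∈s)

  module _ {R : A → A → Set} where

    AllPairs-middle : ∀ (p s : List A) l → AllPairs R (p ++ l ∷ s) →
                      (∀ {z} → z ∈ p → R z l) × (∀ {z} → z ∈ s → R l z)
    AllPairs-middle [] s l (h ∷ _) = (λ ()) , All.lookup h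
    AllPairs-middle (a ∷ p) s l (h ∷ t) =
      (λ { (here refl) → All.lookup h (∈-++⁺ʳ p (here refl))
         ; (there z∈p) → proj₁ (AllPairs-middle p s l t) z∈p }) ,
      proj₂ (AllPairs-middle p s l t)

    AllPairs-ordered : ∀ {u} → AllPairs R u → ∀ p q s {l l'} → u ≡ p ++ l ∷ q ++ l' ∷ s → R l l'
    AllPairs-ordered (h ∷ _) [] q s refl = All.lookup h (∈-++⁺ʳ q (here refl))
    AllPairs-ordered (_ ∷ t) (_ ∷ p) q s refl = AllPairs-ordered t p q s refl

    AllPairs-remove : ∀ (p s : List A) l → AllPairs R (p ++ l ∷ s) → AllPairs R (p ++ s)
    AllPairs-remove [] s l (_ ∷ t) = t
    AllPairs-remove (a ∷ p) s l (h ∷ t) =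
      All.tabulate (λ z∈ → All.lookup h (∈-insert⁺ p s l z∈)) ∷ AllPairs-remove p s l t

    AllPairs-insert : ∀ (p s : List A) l → AllPairs R (p ++ s) →
                      (∀ {z} → z ∈ p → R z l) → (∀ {z} → z ∈ s → R l z) → AllPairs R (p ++ l ∷ s)
    AllPairs-insert [] s l h _ after = All.tabulate after ∷ h
    AllPairs-insert (a ∷ p) s l (h ∷ t) before after =
      All.tabulate (λ z∈ → Sum.[ (λ z∈p → All.lookup h (∈-++⁺ˡ z∈p)) ,
                                Sum.[ (λ { refl → before (here refl) }) ,
                                      (λ z∈s → All.lookup h (∈-++⁺ʳ p z∈s)) ] ] (∈-middle⁻ p s l z∈))
      ∷ AllPairs-insert p s l t (λ z∈p → before (there z∈p)) after

    AllPairs-swap : ∀ (p s : List A) l l' → AllPairs R (p ++ l ∷ l' ∷ s) → R l' l →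
                    AllPairs R (p ++ l' ∷ l ∷ s)
    AllPairs-swap [] s l l' ((_ ∷ hl) ∷ (hl' ∷ t)) r = (r ∷ hl') ∷ (hl ∷ t)
    AllPairs-swap (a ∷ p) s l l' (h ∷ t) r =
      All.tabulate (λ z∈ → All.lookup h (∈-swap p s l' l z∈)) ∷ AllPairs-swap p s l l' t r

  Unique-middle : ∀ (p s : List A) l → Unique (p ++ l ∷ s) → l ∉ p ++ s
  Unique-middle p s l u l∈ with ∈-++⁻ p l∈
  ... | inj₁ l∈p = proj₁ (AllPairs-middle p s l u) l∈p refl
  ... | inj₂ l∈s = proj₂ (AllPairs-middle p s l u) l∈s refl

  Unique-++-disjoint : ∀ (p s : List A) {z} → Unique (p ++ s) → z ∈ s → z ∉ p
  Unique-++-disjoint (a ∷ p) s (h ∷ _) z∈s (here refl) = All.lookup h (∈-++⁺ʳ p z∈s) refl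
  Unique-++-disjoint (a ∷ p) s (_ ∷ t) z∈s (there z∈p) = Unique-++-disjoint p s t z∈s z∈p

  length-insert : ∀ (p s : List A) l → length (p ++ l ∷ s) ≡ suc (length (p ++ s))
  length-insert [] s l = refl
  length-insert (a ∷ p) s l = cong suc (length-insert p s l)

  length-swap : ∀ (p s : List A) l l' → length (p ++ l ∷ l' ∷ s) ≡ length (p ++ l' ∷ l ∷ s)
  length-swap [] s l l' = refl
  length-swap (a ∷ p) s l l' = cong suc (length-swap p s l l')

-- Shuffle words

-- l ≺ l' : the letter l may precede the letter l' in a shuffle word
_≺_ : Letter m n → Letter m n → Set
x i ≺ x i' = toℕ i < toℕ i'
y j ≺ y j' = toℕ j < toℕ j'
x _ ≺ y _ = ⊤
y _ ≺ x _ = ⊤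

Shuffle : Word m n → Set
Shuffle = AllPairs _≺_

≺⇒≢ : {l l' : Letter m n} → l ≺ l' → l ≢ l'
≺⇒≢ {l = x i} i<i refl = <-irrefl refl i<i
≺⇒≢ {l = y j} j<j refl = <-irrefl refl j<j

Shuffle⇒Unique : {u : Word m n} → Shuffle u → Unique u
Shuffle⇒Unique = AllPairs.map ≺⇒≢

Shuffle⇒IsShuffle : {u : Word m n} → Shuffle u → IsShuffle u
Shuffle⇒IsShuffle sh =
  Shuffle⇒Unique sh ,
  (λ p q s i j → AllPairs-ordered sh p q s) ,
  (λ p q s i j → AllPairs-ordered sh p q s)

IsShuffle-head : {l : Letter m n} {s : Word m n} → IsShuffle (l ∷ s) → ∀ {z} → z ∈ s → l ≺ z
IsShuffle-head {l = x i} (_ , xs-ordered , _) {x i'} z∈s =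
  let q , r , e = ∈-∃++ z∈s in xs-ordered [] q r i i' (cong (x i ∷_) e)
IsShuffle-head {l = y j} (_ , _ , ys-ordered) {y j'} z∈s =
  let q , r , e = ∈-∃++ z∈s in ys-ordered [] q r j j' (cong (y j ∷_) e)
IsShuffle-head {l = x _} _ {y _} _ = tt
IsShuffle-head {l = y _} _ {x _} _ = tt

IsShuffle-tail : {l : Letter m n} {s : Word m n} → IsShuffle (l ∷ s) → IsShuffle s
IsShuffle-tail {l = l} (_ ∷ unique , xs-ordered , ys-ordered) =
  unique ,
  (λ p q r i j e → xs-ordered (l ∷ p) q r i j (cong (l ∷_) e)) ,
  (λ p q r i j e → ys-ordered (l ∷ p) q r i j (cong (l ∷_) e))

IsShuffle⇒Shuffle : {u : Word m n} → IsShuffle u → Shuffle u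
IsShuffle⇒Shuffle {u = []} _ = []
IsShuffle⇒Shuffle {u = _ ∷ _} sh =
  All.tabulate (IsShuffle-head sh) ∷ IsShuffle⇒Shuffle (IsShuffle-tail sh)

_≟ₗ_ : (l l' : Letter m n) → Dec (l ≡ l')
x i ≟ₗ x i' with i Fin.≟ i'
... | yes refl = yes refl
... | no i≢i' = no λ { refl → i≢i' refl }
y j ≟ₗ y j' with j Fin.≟ j'
... | yes refl = yes refl
... | no j≢j' = no λ { refl → j≢j' refl }
x _ ≟ₗ y _ = no λ ()
y _ ≟ₗ x _ = no λ ()

#x : Word m n → ℕ
#x [] = 0
#x (x _ ∷ s) = suc (#x s)
#x (y _ ∷ s) = #x s

#y : Word m n → ℕ
#y [] = 0
#y (x _ ∷ s) = #y s
#y (y _ ∷ s) = suc (#y s)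

inversions : Word m n → ℕ
inversions [] = 0
inversions (x _ ∷ s) = inversions s
inversions (y _ ∷ s) = #x s + inversions s

module _ {m n : ℕ} where

  #x-insert : ∀ (p s : Word m n) l → #x (p ++ l ∷ s) ≡ #x [ l ] + #x (p ++ s)
  #x-insert [] s (x _) = refl
  #x-insert [] s (y _) = refl
  #x-insert (x _ ∷ p) s l = trans (cong suc (#x-insert p s l)) (sym (+-suc (#x [ l ]) _))
  #x-insert (y _ ∷ p) s l = #x-insert p s l

  #y-insert : ∀ (p s : Word m n) l → #y (p ++ l ∷ s) ≡ #y [ l ] + #y (p ++ s)
  #y-insert [] s (x _) = refl
  #y-insert [] s (y _) = refl
  #y-insert (x _ ∷ p) s l = #y-insert p s l
  #y-insert (y _ ∷ p) s l = trans (cong suc (#y-insert p s l)) (sym (+-suc (#y [ l ]) _))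

  #x-swap : ∀ (p s : Word m n) i j → #x (p ++ y j ∷ x i ∷ s) ≡ #x (p ++ x i ∷ y j ∷ s)
  #x-swap [] s i j = refl
  #x-swap (x _ ∷ p) s i j = cong suc (#x-swap p s i j)
  #x-swap (y _ ∷ p) s i j = #x-swap p s i j

  #y-swap : ∀ (p s : Word m n) i j → #y (p ++ y j ∷ x i ∷ s) ≡ #y (p ++ x i ∷ y j ∷ s)
  #y-swap [] s i j = refl
  #y-swap (x _ ∷ p) s i j = #y-swap p s i j
  #y-swap (y _ ∷ p) s i j = cong suc (#y-swap p s i j)

  #y-++ : ∀ (p s : Word m n) → #y (p ++ s) ≡ #y p + #y s
  #y-++ [] s = refl
  #y-++ (x _ ∷ p) s = #y-++ p s
  #y-++ (y _ ∷ p) s = cong suc (#y-++ p s)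

  inversions-insertX : ∀ (p s : Word m n) i → inversions (p ++ x i ∷ s) ≡ #y p + inversions (p ++ s)
  inversions-insertX [] s i = refl
  inversions-insertX (x _ ∷ p) s i = inversions-insertX p s i
  inversions-insertX (y _ ∷ p) s i =
    trans (cong₂ _+_ (#x-insert p s (x i)) (inversions-insertX p s i))
          (cong suc (x∙yz≈y∙xz (#x (p ++ s)) (#y p) _))

  inversions-insertY : ∀ (p s : Word m n) j → inversions (p ++ y j ∷ s) ≡ #x s + inversions (p ++ s)
  inversions-insertY [] s j = refl
  inversions-insertY (x _ ∷ p) s j = inversions-insertY p s j
  inversions-insertY (y _ ∷ p) s j =
    trans (cong₂ _+_ (#x-insert p s (y j)) (inversions-insertY p s j))
          (x∙yz≈y∙xz (#x (p ++ s)) (#x s) _)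

  inversions-swap : ∀ (p s : Word m n) i j →
                    inversions (p ++ y j ∷ x i ∷ s) ≡ suc (inversions (p ++ x i ∷ y j ∷ s))
  inversions-swap [] s i j = refl
  inversions-swap (x _ ∷ p) s i j = inversions-swap p s i j
  inversions-swap (y _ ∷ p) s i j =
    trans (cong₂ _+_ (#x-swap p s i j) (inversions-swap p s i j)) (+-suc _ _)

steps : {u v : Word m n} → u ≤Bub v → ℕ
steps ε = 0
steps (_ ◅ π) = suc (steps π)

steps-◅◅ : {u v w : Word m n} (π : u ≤Bub v) (π' : v ≤Bub w) →
           steps (π ◅◅ π') ≡ steps π + steps π'
steps-◅◅ ε π' = refl
steps-◅◅ (_ ◅ π) π' = cong suc (steps-◅◅ π π')

move-#x : {u v : Word m n} → Move u v → #x v ≤ #x u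
move-#x (del p s i) = ≤-trans (n≤1+n _) (≤-reflexive (sym (#x-insert p s (x i))))
move-#x (ins p s j) = ≤-reflexive (#x-insert p s (y j))
move-#x (swap p s i j) = ≤-reflexive (#x-swap p s i j)

move-#y : {u v : Word m n} → Move u v → #y u ≤ #y v
move-#y (del p s i) = ≤-reflexive (#y-insert p s (x i))
move-#y (ins p s j) = ≤-trans (n≤1+n _) (≤-reflexive (sym (#y-insert p s (y j))))
move-#y (swap p s i j) = ≤-reflexive (sym (#y-swap p s i j))

≤Bub-#x : {u v : Word m n} → u ≤Bub v → #x v ≤ #x u
≤Bub-#x ε = ≤-refl
≤Bub-#x ((_ , _ , mv) ◅ π) = ≤-trans (≤Bub-#x π) (move-#x mv)

≤Bub-#y : {u v : Word m n} → u ≤Bub v → #y u ≤ #y v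
≤Bub-#y ε = ≤-refl
≤Bub-#y ((_ , _ , mv) ◅ π) = ≤-trans (move-#y mv) (≤Bub-#y π)

del-≤Bub-#x : ∀ (p s : Word m n) i {v} → (p ++ s) ≤Bub v → #x v < #x (p ++ x i ∷ s)
del-≤Bub-#x p s i π = ≤-trans (s≤s (≤Bub-#x π)) (≤-reflexive (sym (#x-insert p s (x i))))

ins-≤Bub-#y : ∀ (p s : Word m n) j {v} → (p ++ y j ∷ s) ≤Bub v → #y (p ++ s) < #y v
ins-≤Bub-#y p s j π = ≤-trans (≤-reflexive (sym (#y-insert p s (y j)))) (≤Bub-#y π)

swap-steps-inversions : ∀ (p s : Word m n) i j k →
                        k + inversions (p ++ y j ∷ x i ∷ s) ≡ suc k + inversions (p ++ x i ∷ y j ∷ s)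
swap-steps-inversions p s i j k = trans (cong (k +_) (inversions-swap p s i j)) (+-suc k _)

move-irreflexive : {u v : Word m n} → Move u v → u ≢ v
move-irreflexive (del p s i) e = <-irrefl (cong #x (sym e)) (del-≤Bub-#x p s i ε)
move-irreflexive (ins p s j) e = <-irrefl (cong #y e) (ins-≤Bub-#y p s j ε)
move-irreflexive (swap p s i j) e =
  <-irrefl (cong inversions e) (≤-reflexive (sym (inversions-swap p s i j)))

move-y∈ : {u v : Word m n} {j : Fin n} → Move u v → y j ∈ u → y j ∈ v
move-y∈ (del p s i) y∈ = ∈-insert⁻ p s (x i) y∈ λ ()
move-y∈ (ins p s j) y∈ = ∈-insert⁺ p s (y j) y∈
move-y∈ (swap p s i j) y∈ = ∈-swap p s (x i) (y j) y∈

≤Bub-y∈ : {u v : Word m n} {j : Fin n} → u ≤Bub v → y j ∈ u → y j ∈ v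
≤Bub-y∈ ε y∈ = y∈
≤Bub-y∈ ((_ , _ , mv) ◅ π) y∈ = ≤Bub-y∈ π (move-y∈ mv y∈)

move-x∈⁻ : {u v : Word m n} {i : Fin m} → Move u v → x i ∈ v → x i ∈ u
move-x∈⁻ (del p s i) x∈ = ∈-insert⁺ p s (x i) x∈
move-x∈⁻ (ins p s j) x∈ = ∈-insert⁻ p s (y j) x∈ λ ()
move-x∈⁻ (swap p s i j) x∈ = ∈-swap p s (y j) (x i) x∈

≤Bub-x∈⁻ : {u v : Word m n} {i : Fin m} → u ≤Bub v → x i ∈ v → x i ∈ u
≤Bub-x∈⁻ ε x∈ = x∈
≤Bub-x∈⁻ ((_ , _ , mv) ◅ π) x∈ = move-x∈⁻ mv (≤Bub-x∈⁻ π x∈)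

-- the number of x's after y_k (0 if y_k does not occur)
xsAfter : Fin n → Word m n → ℕ
xsAfter k [] = 0
xsAfter k (x _ ∷ s) = xsAfter k s
xsAfter k (y j ∷ s) with j Fin.≟ k
... | yes _ = #x s
... | no _ = xsAfter k s

-- the number of y's before x_k (all of them if x_k does not occur)
ysBefore : Fin m → Word m n → ℕ
ysBefore k [] = 0
ysBefore k (y _ ∷ s) = suc (ysBefore k s)
ysBefore k (x i ∷ s) with i Fin.≟ k
... | yes _ = 0
... | no _ = ysBefore k s

module _ {m n : ℕ} where

  xsAfter≤#x : ∀ k (s : Word m n) → xsAfter k s ≤ #x s
  xsAfter≤#x k [] = z≤n
  xsAfter≤#x k (x _ ∷ s) = m≤n⇒m≤1+n (xsAfter≤#x k s)
  xsAfter≤#x k (y j ∷ s) with j Fin.≟ k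
  ... | yes _ = ≤-refl
  ... | no _ = xsAfter≤#x k s

  xsAfter-insertY : ∀ k (p s : Word m n) j → xsAfter k (p ++ s) ≤ xsAfter k (p ++ y j ∷ s)
  xsAfter-insertY k [] s j with j Fin.≟ k
  ... | yes _ = xsAfter≤#x k s
  ... | no _ = ≤-refl
  xsAfter-insertY k (x _ ∷ p) s j = xsAfter-insertY k p s j
  xsAfter-insertY k (y j' ∷ p) s j with j' Fin.≟ k
  ... | yes _ = ≤-reflexive (sym (#x-insert p s (y j)))
  ... | no _ = xsAfter-insertY k p s j

  xsAfter-swap : ∀ k (p s : Word m n) i j → xsAfter k (p ++ x i ∷ y j ∷ s) ≤ xsAfter k (p ++ y j ∷ x i ∷ s)
  xsAfter-swap k [] s i j with j Fin.≟ k
  ... | yes _ = n≤1+n _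
  ... | no _ = ≤-refl
  xsAfter-swap k (x _ ∷ p) s i j = xsAfter-swap k p s i j
  xsAfter-swap k (y j' ∷ p) s i j with j' Fin.≟ k
  ... | yes _ = ≤-reflexive (sym (#x-swap p s i j))
  ... | no _ = xsAfter-swap k p s i j

  xsAfter-skip : ∀ k (p s : Word m n) → y k ∉ p → xsAfter k (p ++ s) ≡ xsAfter k s
  xsAfter-skip k [] s _ = refl
  xsAfter-skip k (x _ ∷ p) s y∉ = xsAfter-skip k p s (λ y∈ → y∉ (there y∈))
  xsAfter-skip k (y j ∷ p) s y∉ with j Fin.≟ k
  ... | yes refl = ⊥-elim (y∉ (here refl))
  ... | no _ = xsAfter-skip k p s (λ y∈ → y∉ (there y∈))

  xsAfter-here : ∀ k (p s : Word m n) → y k ∉ p → xsAfter k (p ++ y k ∷ s) ≡ #x s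
  xsAfter-here k p s y∉ with xsAfter-skip k p (y k ∷ s) y∉
  ... | e with k Fin.≟ k
  ... | yes _ = e
  ... | no k≢k = ⊥-elim (k≢k refl)

  ysBefore-insertY : ∀ k (p s : Word m n) j → ysBefore k (p ++ s) ≤ ysBefore k (p ++ y j ∷ s)
  ysBefore-insertY k [] s j = n≤1+n _
  ysBefore-insertY k (y _ ∷ p) s j = s≤s (ysBefore-insertY k p s j)
  ysBefore-insertY k (x i ∷ p) s j with i Fin.≟ k
  ... | yes _ = ≤-refl
  ... | no _ = ysBefore-insertY k p s j

  ysBefore-swap : ∀ k (p s : Word m n) i j → ysBefore k (p ++ x i ∷ y j ∷ s) ≤ ysBefore k (p ++ y j ∷ x i ∷ s)
  ysBefore-swap k [] s i j with i Fin.≟ k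
  ... | yes _ = z≤n
  ... | no _ = ≤-refl
  ysBefore-swap k (y _ ∷ p) s i j = s≤s (ysBefore-swap k p s i j)
  ysBefore-swap k (x i' ∷ p) s i j with i' Fin.≟ k
  ... | yes _ = ≤-refl
  ... | no _ = ysBefore-swap k p s i j

  ysBefore-skip : ∀ k (p s : Word m n) → x k ∉ p → ysBefore k (p ++ s) ≡ #y p + ysBefore k s
  ysBefore-skip k [] s _ = refl
  ysBefore-skip k (y _ ∷ p) s x∉ = cong suc (ysBefore-skip k p s (λ x∈ → x∉ (there x∈)))
  ysBefore-skip k (x i ∷ p) s x∉ with i Fin.≟ k
  ... | yes refl = ⊥-elim (x∉ (here refl))
  ... | no _ = ysBefore-skip k p s (λ x∈ → x∉ (there x∈))

  ysBefore-here : ∀ k (p s : Word m n) → x k ∉ p → ysBefore k (p ++ x k ∷ s) ≡ #y p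
  ysBefore-here k p s x∉ with ysBefore-skip k p (x k ∷ s) x∉
  ... | e with k Fin.≟ k
  ... | yes _ = trans e (+-identityʳ _)
  ... | no k≢k = ⊥-elim (k≢k refl)

-- without deletions, y's only ever get inserted or moved left past x's
ysBefore-≤Bub : ∀ k {u v : Word m n} → u ≤Bub v → #x u ≡ #x v → ysBefore k u ≤ ysBefore k v
ysBefore-≤Bub k ε _ = ≤-refl
ysBefore-≤Bub k ((_ , _ , del p s i) ◅ π) ex = ⊥-elim (<⇒≢ (del-≤Bub-#x p s i π) (sym ex))
ysBefore-≤Bub k ((_ , _ , ins p s j) ◅ π) ex =
  ≤-trans (ysBefore-insertY k p s j) (ysBefore-≤Bub k π (trans (#x-insert p s (y j)) ex))
ysBefore-≤Bub k ((_ , _ , swap p s i j) ◅ π) ex =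
  ≤-trans (ysBefore-swap k p s i j) (ysBefore-≤Bub k π (trans (#x-swap p s i j) ex))

-- With #x and #y fixed, every move is a swap, which creates exactly one inversion.
swaps-steps : {u v : Word m n} (π : u ≤Bub v) → #x u ≡ #x v → #y u ≡ #y v →
              steps π + inversions u ≤ inversions v
swaps-steps ε _ _ = ≤-refl
swaps-steps ((_ , _ , del p s i) ◅ π) ex _ = ⊥-elim (<⇒≢ (del-≤Bub-#x p s i π) (sym ex))
swaps-steps ((_ , _ , ins p s j) ◅ π) _ ey = ⊥-elim (<⇒≢ (ins-≤Bub-#y p s j π) ey)
swaps-steps {v = v} ((_ , _ , swap p s i j) ◅ π) ex ey =
  subst (_≤ inversions v) (swap-steps-inversions p s i j (steps π))
    (swaps-steps π (trans (#x-swap p s i j) ex) (trans (#y-swap p s i j) ey))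

-- Some y_k of u that must stay to the right of every y still to be inserted already has
-- K x's to its right; hence so will the y that gets inserted.
InsertionBound : ℕ → Word m n → Word m n → Set
InsertionBound {n = n} K u v =
  K ≡ 0 ⊎ ∃ λ (k : Fin n) → y k ∈ u × K ≤ xsAfter k u ×
                            (∀ j → y j ∈ v → y j ∉ u → toℕ j < toℕ k)

insertionBound-≤ : ∀ {v : Word m n} K (p s : Word m n) j →
                   IsShuffle (p ++ s) → IsShuffle (p ++ y j ∷ s) →
                   (p ++ y j ∷ s) ≤Bub v → InsertionBound K (p ++ s) v → K ≤ #x s
insertionBound-≤ K p s j _ _ _ (inj₁ refl) = z≤n
insertionBound-≤ K p s j sh sh′ π (inj₂ (k , yk∈ , K≤ , before-k)) with ∈-++⁻ p yk∈
... | inj₁ yk∈p =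
  ⊥-elim (<-asym (before-k j (≤Bub-y∈ π (∈-++⁺ʳ p (here refl)))
                             (Unique-middle p s (y j) (proj₁ sh′)))
                 (proj₁ (AllPairs-middle p s (y j) (IsShuffle⇒Shuffle sh′)) yk∈p))
... | inj₂ yk∈s =
  ≤-trans K≤ (≤-trans (≤-reflexive (xsAfter-skip k p s (Unique-++-disjoint p s (proj₁ sh) yk∈s)))
                      (xsAfter≤#x k s))

oneInsertion-steps : ∀ {u v : Word m n} K (π : u ≤Bub v) → #x u ≡ #x v → #y v ≡ suc (#y u) →
                     InsertionBound K u v → steps π + inversions u + K ≤ suc (inversions v)
oneInsertion-steps K ε _ ey _ = ⊥-elim (1+n≰n (≤-reflexive (sym ey)))
oneInsertion-steps K ((_ , _ , del p s i) ◅ π) ex _ _ = ⊥-elim (<⇒≢ (del-≤Bub-#x p s i π) (sym ex))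
oneInsertion-steps {v = v} K ((_ , _ , swap p s i j) ◅ π) ex ey bound =
  subst (λ t → t + K ≤ suc (inversions v)) (swap-steps-inversions p s i j (steps π))
    (oneInsertion-steps K π (trans (#x-swap p s i j) ex) (trans ey (cong suc (sym (#y-swap p s i j))))
       (Sum.map₂ (λ (k , yk∈ , K≤ , before-k) →
                    k , move-y∈ (swap p s i j) yk∈ , ≤-trans K≤ (xsAfter-swap k p s i j) ,
                    λ j′ yj′∈v yj′∉ → before-k j′ yj′∈v (λ yj′∈ → yj′∉ (move-y∈ (swap p s i j) yj′∈)))
                 bound))
oneInsertion-steps {u = u} {v} K ((sh , sh′ , ins p s j) ◅ π) ex ey bound = s≤s (begin
  steps π + inversions u + K          ≤⟨ +-monoʳ-≤ (steps π + inversions u)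
                                                    (insertionBound-≤ K p s j sh sh′ π bound) ⟩
  steps π + inversions u + #x s       ≡⟨ +-assoc (steps π) (inversions u) (#x s) ⟩
  steps π + (inversions u + #x s)     ≡⟨ cong (steps π +_) (+-comm (inversions u) (#x s)) ⟩
  steps π + (#x s + inversions u)     ≡⟨ cong (steps π +_) (sym (inversions-insertY p s j)) ⟩
  steps π + inversions (p ++ y j ∷ s) ≤⟨ swaps-steps π (trans (#x-insert p s (y j)) ex)
                                                       (trans (#y-insert p s (y j)) (sym ey)) ⟩
  inversions v                        ∎)
  where open ≤-Reasoning

-- Dually, some x_k of v that every x still to be deleted must precede has at most D y's
-- to its left; hence so does the x that gets deleted.
DeletionBound : ℕ → Word m n → Word m n → Set
DeletionBound {m = m} D u v =
  D ≡ #y v ⊎ ∃ λ (k : Fin m) → x k ∈ v × ysBefore k v ≤ D ×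
                              (∀ i → x i ∈ u → x i ∉ v → toℕ i < toℕ k)

deletionBound-≤ : ∀ {v : Word m n} D (p s : Word m n) i →
                  IsShuffle (p ++ x i ∷ s) → IsShuffle (p ++ s) → (p ++ s) ≤Bub v →
                  #y (p ++ x i ∷ s) ≡ #y v → #x (p ++ x i ∷ s) ≡ suc (#x v) →
                  DeletionBound D (p ++ x i ∷ s) v → #y p ≤ D
deletionBound-≤ D p s i _ _ _ ey _ (inj₁ refl) =
  ≤-trans (m≤m+n (#y p) (#y s))
          (≤-reflexive (trans (sym (#y-++ p s)) (trans (sym (#y-insert p s (x i))) ey)))
deletionBound-≤ {v = v} D p s i sh sh′ π _ ex (inj₂ (k , xk∈ , ≤D , after-k))
  with ∈-++⁻ p (≤Bub-x∈⁻ π xk∈)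
... | inj₁ xk∈p =
  ⊥-elim (<-asym (after-k i (∈-++⁺ʳ p (here refl))
                            (λ xi∈ → Unique-middle p s (x i) (proj₁ sh) (≤Bub-x∈⁻ π xi∈)))
                 (proj₁ (AllPairs-middle p s (x i) (IsShuffle⇒Shuffle sh)) xk∈p))
... | inj₂ xk∈s = begin
  #y p                 ≤⟨ m≤m+n (#y p) (ysBefore k s) ⟩
  #y p + ysBefore k s  ≡⟨ sym (ysBefore-skip k p s (Unique-++-disjoint p s (proj₁ sh′) xk∈s)) ⟩
  ysBefore k (p ++ s)  ≤⟨ ysBefore-≤Bub k π (suc-injective (trans (sym (#x-insert p s (x i))) ex)) ⟩
  ysBefore k v         ≤⟨ ≤D ⟩
  D                    ∎
  where open ≤-Reasoning

oneDeletion-steps : ∀ {u v : Word m n} D (π : u ≤Bub v) → #y u ≡ #y v → #x u ≡ suc (#x v) →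
                    DeletionBound D u v → steps π + inversions u ≤ suc (D + inversions v)
oneDeletion-steps D ε _ ex _ = ⊥-elim (1+n≰n (≤-reflexive (sym ex)))
oneDeletion-steps D ((_ , _ , ins p s j) ◅ π) ey _ _ = ⊥-elim (<⇒≢ (ins-≤Bub-#y p s j π) ey)
oneDeletion-steps {v = v} D ((_ , _ , swap p s i j) ◅ π) ey ex bound =
  subst (_≤ suc (D + inversions v)) (swap-steps-inversions p s i j (steps π))
    (oneDeletion-steps D π (trans (#y-swap p s i j) ey) (trans (#x-swap p s i j) ex)
       (Sum.map₂ (λ (k , xk∈ , ≤D , after-k) →
                    k , xk∈ , ≤D , λ i′ xi′∈ → after-k i′ (move-x∈⁻ (swap p s i j) xi′∈))
                 bound))
oneDeletion-steps {u = u} {v} D ((sh , sh′ , del p s i) ◅ π) ey ex bound = s≤s (begin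
  steps π + inversions u                 ≡⟨ cong (steps π +_) (inversions-insertX p s i) ⟩
  steps π + (#y p + inversions (p ++ s)) ≡⟨ x∙yz≈y∙xz (steps π) (#y p) _ ⟩
  #y p + (steps π + inversions (p ++ s)) ≤⟨ +-mono-≤ (deletionBound-≤ D p s i sh sh′ π ey ex bound)
                                                      (swaps-steps π #x≡ (trans (sym (#y-insert p s (x i))) ey)) ⟩
  D + inversions v                       ∎)
  where
  open ≤-Reasoning
  #x≡ : #x (p ++ s) ≡ #x v
  #x≡ = suc-injective (trans (sym (#x-insert p s (x i))) ex)

-- Lower covers

steps≤1⇒cover : {v u : Word m n} → (∀ (π : v ≤Bub u) → steps π ≤ 1) →
                ∀ w → v ≤Bub w → w ≤Bub u → w ≡ v ⊎ w ≡ u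
steps≤1⇒cover _ w ε _ = inj₁ refl
steps≤1⇒cover _ w (_ ◅ _) ε = inj₂ refl
steps≤1⇒cover short w (r ◅ π) (r' ◅ π') =
  case subst (_≤ 0) (trans (steps-◅◅ π (r' ◅ π')) (+-suc (steps π) (steps π')))
             (s≤s⁻¹ (short ((r ◅ π) ◅◅ (r' ◅ π')))) of λ ()

move-⋖ : {v u : Word m n} → Move v u → Shuffle v → Shuffle u →
         (∀ (π : v ≤Bub u) → steps π ≤ 1) → v ⋖ u
move-⋖ {v = v} {u} mv shv shu short =
  isv , isu , (isv , isu , mv) ◅ ε , move-irreflexive mv , steps≤1⇒cover short
  where
  isv : IsShuffle v
  isv = Shuffle⇒IsShuffle shv
  isu : IsShuffle u
  isu = Shuffle⇒IsShuffle shu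

last-step : {u v : Word m n} → u ≤Bub v → u ≡ v ⊎ ∃ λ w → u ≤Bub w × ShufMove w v
last-step ε = inj₁ refl
last-step (r ◅ π) with last-step π
... | inj₁ refl = inj₂ (_ , ε , r)
... | inj₂ (w , π' , r') = inj₂ (w , r ◅ π' , r')

⋖⇒ShufMove : {v u : Word m n} → v ⋖ u → ShufMove v u
⋖⇒ShufMove (_ , _ , π , v≢u , cover) with last-step π
... | inj₁ v≡u = ⊥-elim (v≢u v≡u)
... | inj₂ (w , π' , r) with cover w π' (r ◅ ε)
...   | inj₁ refl = r
...   | inj₂ refl = ⊥-elim (move-irreflexive (proj₂ (proj₂ r)) refl)

swap-⋖ : ∀ (p s : Word m n) i j → Shuffle (p ++ y j ∷ x i ∷ s) →
         (p ++ x i ∷ y j ∷ s) ⋖ (p ++ y j ∷ x i ∷ s)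
swap-⋖ p s i j sh = move-⋖ (swap p s i j) (AllPairs-swap p s (y j) (x i) sh tt) sh λ π →
  +-cancelʳ-≤ _ (steps π) 1
    (≤-trans (swaps-steps π (sym (#x-swap p s i j)) (sym (#y-swap p s i j)))
             (≤-reflexive (inversions-swap p s i j)))

StartsWithY : Word m n → Set
StartsWithY {n = n} u = ∃ λ (j : Fin n) → ∃ λ s → u ≡ y j ∷ s

-- Inserting y_j is a cover unless an x follows it, which could instead be swapped past it.
insertY-⋖ : ∀ (p s : Word m n) j → Shuffle (p ++ y j ∷ s) → s ≡ [] ⊎ StartsWithY s →
            (p ++ s) ⋖ (p ++ y j ∷ s)
insertY-⋖ p s j sh end = move-⋖ (ins p s j) (AllPairs-remove p s (y j) sh) sh λ π →
  +-cancelʳ-≤ (#x s + inversions (p ++ s)) (steps π) 1 (begin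
    steps π + (#x s + inversions (p ++ s)) ≡⟨ cong (steps π +_) (+-comm (#x s) _) ⟩
    steps π + (inversions (p ++ s) + #x s) ≡⟨ sym (+-assoc (steps π) _ (#x s)) ⟩
    steps π + inversions (p ++ s) + #x s   ≤⟨ oneInsertion-steps (#x s) π (sym (#x-insert p s (y j)))
                                                                   (#y-insert p s (y j)) (bound end) ⟩
    suc (inversions (p ++ y j ∷ s))        ≡⟨ cong suc (inversions-insertY p s j) ⟩
    suc (#x s + inversions (p ++ s))       ∎)
  where
  open ≤-Reasoning
  bound : s ≡ [] ⊎ StartsWithY s → InsertionBound (#x s) (p ++ s) (p ++ y j ∷ s)
  bound (inj₁ refl) = inj₁ refl
  bound (inj₂ (k , s' , refl)) =
    inj₂ (k , ∈-++⁺ʳ p (here refl) , ≤-reflexive (sym (xsAfter-here k p s' yk∉p)) , only-yj)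
    where
    yk∉p : y k ∉ p
    yk∉p = Unique-++-disjoint p (y j ∷ y k ∷ s') (Shuffle⇒Unique sh) (there (here refl))
    only-yj : ∀ j′ → y j′ ∈ p ++ y j ∷ y k ∷ s' → y j′ ∉ p ++ y k ∷ s' → toℕ j′ < toℕ k
    only-yj j′ yj′∈ yj′∉ with ∈-middle⁻ p (y k ∷ s') (y j) yj′∈
    ... | inj₁ yj′∈p = ⊥-elim (yj′∉ (∈-++⁺ˡ yj′∈p))
    ... | inj₂ (inj₁ refl) = proj₂ (AllPairs-middle p (y k ∷ s') (y j) sh) (here refl)
    ... | inj₂ (inj₂ yj′∈s) = ⊥-elim (yj′∉ (∈-++⁺ʳ p yj′∈s))

EmptyOrXAbove : Fin m → Word m n → Set
EmptyOrXAbove i s = s ≡ [] ⊎ ∃ λ k → ∃ λ s' → s ≡ x k ∷ s' × toℕ i < toℕ k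

-- Deleting x_i is a cover when x_i sits as far right as the shuffle condition allows.
deleteX-⋖ : ∀ (p s : Word m n) i → Shuffle (p ++ s) → (∀ {z} → z ∈ p → z ≺ x i) →
            EmptyOrXAbove i s → (p ++ x i ∷ s) ⋖ (p ++ s)
deleteX-⋖ p s i sh before next = move-⋖ (del p s i) sh′ sh λ π →
  +-cancelʳ-≤ (#y p + inversions (p ++ s)) (steps π) 1
    (≤-trans (≤-reflexive (cong (steps π +_) (sym (inversions-insertX p s i))))
             (oneDeletion-steps (#y p) π (#y-insert p s (x i)) (#x-insert p s (x i)) (bound next)))
  where
  after : EmptyOrXAbove i s → ∀ {z} → z ∈ s → x i ≺ z
  after (inj₂ (k , s' , refl , i<k)) (here refl) = i<k
  after (inj₂ (k , s' , refl , i<k)) {x _} (there z∈s') =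
    <-trans i<k (proj₂ (AllPairs-middle p s' (x k) sh) z∈s')
  after (inj₂ (k , s' , refl , i<k)) {y _} (there _) = tt
  sh′ : Shuffle (p ++ x i ∷ s)
  sh′ = AllPairs-insert p s (x i) sh before (after next)
  bound : EmptyOrXAbove i s → DeletionBound (#y p) (p ++ x i ∷ s) (p ++ s)
  bound (inj₁ refl) = inj₁ (cong #y (sym (++-identityʳ p)))
  bound (inj₂ (k , s' , refl , i<k)) =
    inj₂ (k , ∈-++⁺ʳ p (here refl) , ≤-reflexive (ysBefore-here k p s' xk∉p) , only-xi)
    where
    xk∉p : x k ∉ p
    xk∉p = Unique-++-disjoint p (x k ∷ s') (Shuffle⇒Unique sh) (here refl)
    only-xi : ∀ i′ → x i′ ∈ p ++ x i ∷ x k ∷ s' → x i′ ∉ p ++ x k ∷ s' → toℕ i′ < toℕ k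
    only-xi i′ xi′∈ xi′∉ with ∈-middle⁻ p (x k ∷ s') (x i) xi′∈
    ... | inj₁ xi′∈p = ⊥-elim (xi′∉ (∈-++⁺ˡ xi′∈p))
    ... | inj₂ (inj₁ refl) = i<k
    ... | inj₂ (inj₂ xi′∈s) = ⊥-elim (xi′∉ (∈-++⁺ʳ p xi′∈s))

-- Words without indel lower covers

YsFollowedByX : Word m n → Set
YsFollowedByX [] = ⊤
YsFollowedByX (x _ ∷ s) = YsFollowedByX s
YsFollowedByX (y _ ∷ []) = ⊥
YsFollowedByX (y _ ∷ x _ ∷ s) = YsFollowedByX s
YsFollowedByX (y _ ∷ y _ ∷ s) = ⊥

YsFollowedByX-tail : ∀ (l : Letter m n) s → YsFollowedByX (l ∷ s) → YsFollowedByX s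
YsFollowedByX-tail (x _) s h = h
YsFollowedByX-tail (y _) (x _ ∷ s) h = h

YsFollowedByX-next : ∀ (p s : Word m n) j → YsFollowedByX (p ++ y j ∷ s) →
                     ∃ λ i → ∃ λ s' → s ≡ x i ∷ s'
YsFollowedByX-next [] (x i ∷ s') j _ = i , s' , refl
YsFollowedByX-next (l ∷ p) s j h =
  YsFollowedByX-next p s j (YsFollowedByX-tail l (p ++ y j ∷ s) h)

HasAllX : Word m n → Set
HasAllX {m = m} u = (i : Fin m) → x i ∈ u

SwapDown : Word m n → Word m n → Set
SwapDown v u =
  ∃ λ p → ∃ λ s → ∃ λ i → ∃ λ j → u ≡ p ++ y j ∷ x i ∷ s × v ≡ p ++ x i ∷ y j ∷ s

SwapDown-∷ : ∀ {v u : Word m n} l → SwapDown v u → SwapDown (l ∷ v) (l ∷ u)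
SwapDown-∷ l (p , s , i , j , refl , refl) = l ∷ p , s , i , j , refl , refl

SwapDown-length : {v u : Word m n} → SwapDown v u → length v ≡ length u
SwapDown-length (p , s , i , j , refl , refl) = length-swap p s (x i) (y j)

IndelDiff-length : {v u : Word m n} → IndelDiff v u → length v ≢ length u
IndelDiff-length (p , s , l , inj₁ (refl , refl)) e = 1+n≢n (trans (sym (length-insert p s l)) (sym e))
IndelDiff-length (p , s , l , inj₂ (refl , refl)) e = 1+n≢n (trans (sym (length-insert p s l)) e)

swapDowns : Word m n → List (Word m n)
swapDowns [] = []
swapDowns (x i ∷ s) = map (x i ∷_) (swapDowns s)
swapDowns (y j ∷ []) = []
swapDowns (y j ∷ x i ∷ s) = (x i ∷ y j ∷ s) ∷ map (y j ∷_) (swapDowns (x i ∷ s))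
swapDowns (y j ∷ y k ∷ s) = map (y j ∷_) (swapDowns (y k ∷ s))

swapDowns-∷ : ∀ (l : Letter m n) u {v} → v ∈ swapDowns u → (l ∷ v) ∈ swapDowns (l ∷ u)
swapDowns-∷ (x i) u v∈ = ∈-map⁺ _ v∈
swapDowns-∷ (y j) (x i ∷ s) v∈ = there (∈-map⁺ _ v∈)
swapDowns-∷ (y j) (y k ∷ s) v∈ = ∈-map⁺ _ v∈

∈-swapDowns⁺ : {v u : Word m n} → SwapDown v u → v ∈ swapDowns u
∈-swapDowns⁺ ([] , s , i , j , refl , refl) = here refl
∈-swapDowns⁺ (l ∷ p , s , i , j , refl , refl) =
  swapDowns-∷ l (p ++ y j ∷ x i ∷ s) (∈-swapDowns⁺ (p , s , i , j , refl , refl))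

∈-swapDowns⁻ : ∀ (u : Word m n) {v} → v ∈ swapDowns u → SwapDown v u
∈-swapDowns⁻ (x i ∷ s) v∈ with ∈-map⁻ _ v∈
... | _ , v′∈ , refl = SwapDown-∷ (x i) (∈-swapDowns⁻ s v′∈)
∈-swapDowns⁻ (y j ∷ x i ∷ s) (here refl) = [] , s , i , j , refl , refl
∈-swapDowns⁻ (y j ∷ x i ∷ s) (there v∈) with ∈-map⁻ _ v∈
... | _ , v′∈ , refl = SwapDown-∷ (y j) (∈-swapDowns⁻ (x i ∷ s) v′∈)
∈-swapDowns⁻ (y j ∷ y k ∷ s) v∈ with ∈-map⁻ _ v∈
... | _ , v′∈ , refl = SwapDown-∷ (y j) (∈-swapDowns⁻ (y k ∷ s) v′∈)

swapDowns-unique : (u : Word m n) → Unique (swapDowns u)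
swapDowns-unique [] = []
swapDowns-unique (x i ∷ s) = Uniqueₚ.map⁺ ∷-injectiveʳ (swapDowns-unique s)
swapDowns-unique (y j ∷ []) = []
swapDowns-unique (y j ∷ x i ∷ s) =
  All.tabulate (λ v∈ e → first∉ e v∈) ∷ Uniqueₚ.map⁺ ∷-injectiveʳ (swapDowns-unique (x i ∷ s))
  where
  first∉ : ∀ {v} → (x i ∷ y j ∷ s) ≡ v → v ∉ map (y j ∷_) (swapDowns (x i ∷ s))
  first∉ refl v∈ with ∈-map⁻ _ v∈
  ... | _ , _ , ()
swapDowns-unique (y j ∷ y k ∷ s) = Uniqueₚ.map⁺ ∷-injectiveʳ (swapDowns-unique (y k ∷ s))

swapDowns-length : (u : Word m n) → YsFollowedByX u → length (swapDowns u) ≡ #y u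
swapDowns-length [] _ = refl
swapDowns-length (x i ∷ s) h = trans (length-map _ (swapDowns s)) (swapDowns-length s h)
swapDowns-length (y j ∷ x i ∷ s) h =
  cong suc (trans (length-map _ (swapDowns (x i ∷ s))) (swapDowns-length (x i ∷ s) h))

SwapDown⇒⋖ : {v u : Word m n} → Shuffle u → SwapDown v u → v ⋖ u
SwapDown⇒⋖ sh (p , s , i , j , refl , refl) = swap-⋖ p s i j sh

-- An insertion of y_j into such a word is followed by an x_i, so it factors as
-- inserting y_j after x_i and then swapping.
⋖⇒SwapDown : {v u : Word m n} → HasAllX u → YsFollowedByX u → v ⋖ u → SwapDown v u
⋖⇒SwapDown all-x paired v⋖u@(_ , _ , _ , _ , cover) with ⋖⇒ShufMove v⋖u
... | shv , _ , del p s i = ⊥-elim (Unique-middle p s (x i) (proj₁ shv) (all-x i))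
... | _ , _ , swap p s i j = p , s , i , j , refl , refl
... | shv , shu , ins p s j with YsFollowedByX-next p s j paired
...   | i , s' , refl =
  ⊥-elim (Sum.[ (λ w≡v → move-irreflexive insertion (sym w≡v)) ,
                (λ w≡u → move-irreflexive swapping w≡u) ]
                (cover w ((shv , shw , insertion) ◅ ε) ((shw , shu , swapping) ◅ ε)))
  where
  w : Word _ _
  w = p ++ x i ∷ y j ∷ s'
  shw : IsShuffle w
  shw = Shuffle⇒IsShuffle (AllPairs-swap p s' (y j) (x i) (IsShuffle⇒Shuffle shu) tt)
  insertion : Move (p ++ x i ∷ s') w
  insertion = subst₂ Move (++-assoc p [ x i ] s') (++-assoc p [ x i ] (y j ∷ s')) (ins (p ++ [ x i ]) s' j)
  swapping : Move w (p ++ y j ∷ x i ∷ s')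
  swapping = swap p s' i j

good-inDeg : {u : Word m n} → Shuffle u → HasAllX u → YsFollowedByX u → InDeg u (#y u)
good-inDeg {u = u} sh all-x paired =
  swapDowns u , swapDowns-unique u , swapDowns-length u paired ,
  λ v → (λ v∈ → SwapDown⇒⋖ sh (∈-swapDowns⁻ u v∈)) ,
        (λ v⋖u → ∈-swapDowns⁺ (⋖⇒SwapDown all-x paired v⋖u))

good-inDegIndel : {u : Word m n} → HasAllX u → YsFollowedByX u → InDegIndel u 0
good-inDegIndel all-x paired =
  Card-∅ λ v (v⋖u , indel) → IndelDiff-length indel (SwapDown-length (⋖⇒SwapDown all-x paired v⋖u))

YsFollowedByX-or-unpairedY : (u : Word m n) →
  YsFollowedByX u ⊎ ∃ λ p → ∃ λ j → ∃ λ s → u ≡ p ++ y j ∷ s × (s ≡ [] ⊎ StartsWithY s)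
YsFollowedByX-or-unpairedY [] = inj₁ tt
YsFollowedByX-or-unpairedY (x i ∷ s) =
  Sum.map₂ (λ (p , j , r , e , end) → x i ∷ p , j , r , cong (x i ∷_) e , end)
           (YsFollowedByX-or-unpairedY s)
YsFollowedByX-or-unpairedY (y j ∷ []) = inj₂ ([] , j , [] , refl , inj₁ refl)
YsFollowedByX-or-unpairedY (y j ∷ x i ∷ s) =
  Sum.map₂ (λ (p , j′ , r , e , end) → y j ∷ x i ∷ p , j′ , r , cong (λ t → y j ∷ x i ∷ t) e , end)
           (YsFollowedByX-or-unpairedY s)
YsFollowedByX-or-unpairedY (y j ∷ y k ∷ s) = inj₂ ([] , j , y k ∷ s , refl , inj₂ (k , s , refl))

slotForX : ∀ (u : Word m n) i → x i ∉ u →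
           ∃ λ p → ∃ λ s → u ≡ p ++ s × (∀ {z} → z ∈ p → z ≺ x i) × EmptyOrXAbove i s
slotForX [] i _ = [] , [] , refl , (λ ()) , inj₁ refl
slotForX (y j ∷ u) i x∉ =
  let p , s , e , before , next = slotForX u i (λ x∈ → x∉ (there x∈))
  in y j ∷ p , s , cong (y j ∷_) e , (λ { (here refl) → tt ; (there z∈p) → before z∈p }) , next
slotForX (x i′ ∷ u) i x∉ with <-cmp (toℕ i′) (toℕ i)
... | tri< i′<i _ _ =
  let p , s , e , before , next = slotForX u i (λ x∈ → x∉ (there x∈))
  in x i′ ∷ p , s , cong (x i′ ∷_) e , (λ { (here refl) → i′<i ; (there z∈p) → before z∈p }) , next
... | tri≈ _ i′≡i _ = ⊥-elim (x∉ (here (cong x (sym (Finₚ.toℕ-injective i′≡i)))))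
... | tri> _ _ i<i′ = [] , x i′ ∷ u , refl , (λ ()) , inj₂ (i′ , u , refl , i<i′)

noIndelCover⇒good : {u : Word m n} → Shuffle u → InDegIndel u 0 → HasAllX u × YsFollowedByX u
noIndelCover⇒good {m = m} {u = u} sh none = all-x , paired
  where
  no-indel-cover : ∀ {v} → v ⋖ u → ¬ IndelDiff v u
  no-indel-cover {v} v⋖u indel = Card-0⇒∅ none v (v⋖u , indel)
  paired : YsFollowedByX u
  paired with YsFollowedByX-or-unpairedY u
  ... | inj₁ ok = ok
  ... | inj₂ (p , j , s , refl , end) =
    ⊥-elim (no-indel-cover (insertY-⋖ p s j sh end) (p , s , y j , inj₁ (refl , refl)))
  all-x : HasAllX u
  all-x with Finₚ.all? (λ i → any? (x i ≟ₗ_) u)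
  ... | yes ok = ok
  ... | no ¬all with Finₚ.¬∀⟶∃¬ m (λ i → x i ∈ u) (λ i → any? (x i ≟ₗ_) u) ¬all
  ...   | i , x∉ with slotForX u i x∉
  ...     | p , s , refl , before , next =
    ⊥-elim (no-indel-cover (deleteX-⋖ p s i sh before next) (p , s , x i , inj₂ (refl , refl)))

relabel : OrderEmbedding m m' → OrderEmbedding n n' → Letter m n → Letter m' n'
relabel r c (x i) = x (embed r i)
relabel r c (y j) = y (embed c j)

module Relabel (r : OrderEmbedding m m') (c : OrderEmbedding n n') where

  relabelWord : Word m n → Word m' n'
  relabelWord = map (relabel r c)

  relabel-injective : Injective _≡_ _≡_ (relabel r c)
  relabel-injective {x i} {x i'} e =
    cong x (embed-injective r (cong (λ { (x k) → k ; (y _) → embed r i }) e))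
  relabel-injective {y j} {y j'} e =
    cong y (embed-injective c (cong (λ { (y k) → k ; (x _) → embed c j }) e))

  relabelWord-injective : Injective _≡_ _≡_ relabelWord
  relabelWord-injective = map-injective relabel-injective

  relabel-≺ : {l l' : Letter m n} → l ≺ l' → relabel r c l ≺ relabel r c l'
  relabel-≺ {x _} {x _} i<i' = embed-monotone r i<i'
  relabel-≺ {y _} {y _} j<j' = embed-monotone c j<j'
  relabel-≺ {x _} {y _} _ = tt
  relabel-≺ {y _} {x _} _ = tt

  relabel-≺⁻ : {l l' : Letter m n} → relabel r c l ≺ relabel r c l' → l ≺ l'
  relabel-≺⁻ {x _} {x _} i<i' = embed-reflects r i<i'
  relabel-≺⁻ {y _} {y _} j<j' = embed-reflects c j<j'
  relabel-≺⁻ {x _} {y _} _ = tt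
  relabel-≺⁻ {y _} {x _} _ = tt

  Shuffle-relabel : {u : Word m n} → Shuffle u → Shuffle (relabelWord u)
  Shuffle-relabel sh = AllPairsₚ.map⁺ (AllPairs.map relabel-≺ sh)

  Shuffle-relabel⁻ : {u : Word m n} → Shuffle (relabelWord u) → Shuffle u
  Shuffle-relabel⁻ sh = AllPairs.map relabel-≺⁻ (AllPairsₚ.map⁻ sh)

  ∈-relabel⁻ : {l : Letter m n} {u : Word m n} → relabel r c l ∈ relabelWord u → l ∈ u
  ∈-relabel⁻ l∈ with ∈-map⁻ (relabel r c) l∈
  ... | _ , l′∈ , e with relabel-injective e
  ... | refl = l′∈

  #y-relabel : (u : Word m n) → #y (relabelWord u) ≡ #y u
  #y-relabel [] = refl
  #y-relabel (x _ ∷ u) = #y-relabel u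
  #y-relabel (y _ ∷ u) = cong suc (#y-relabel u)

  YsFollowedByX-relabel : (u : Word m n) → YsFollowedByX u → YsFollowedByX (relabelWord u)
  YsFollowedByX-relabel [] _ = tt
  YsFollowedByX-relabel (x _ ∷ u) h = YsFollowedByX-relabel u h
  YsFollowedByX-relabel (y _ ∷ x _ ∷ u) h = YsFollowedByX-relabel u h

  YsFollowedByX-relabel⁻ : (u : Word m n) → YsFollowedByX (relabelWord u) → YsFollowedByX u
  YsFollowedByX-relabel⁻ [] _ = tt
  YsFollowedByX-relabel⁻ (x _ ∷ u) h = YsFollowedByX-relabel⁻ u h
  YsFollowedByX-relabel⁻ (y _ ∷ []) h = h
  YsFollowedByX-relabel⁻ (y _ ∷ x _ ∷ u) h = YsFollowedByX-relabel⁻ u h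
  YsFollowedByX-relabel⁻ (y _ ∷ y _ ∷ u) h = h

module ShiftX {m n} = Relabel {m} {suc m} {n} {n} sucEmbedding idEmbedding
module ShiftY {m n} = Relabel {m} {m} {n} {suc n} idEmbedding sucEmbedding
module ShiftXY {m n} = Relabel {m} {suc m} {n} {suc n} sucEmbedding sucEmbedding

shiftX : Word m n → Word (suc m) n
shiftX = ShiftX.relabelWord

shiftY : Word m n → Word m (suc n)
shiftY = ShiftY.relabelWord

shiftXY : Word m n → Word (suc m) (suc n)
shiftXY = ShiftXY.relabelWord

unshiftX : (u : Word (suc m) n) → x zero ∉ u → ∃ λ u' → shiftX u' ≡ u
unshiftX [] _ = [] , refl
unshiftX (x zero ∷ u) x∉ = ⊥-elim (x∉ (here refl))
unshiftX (x (suc i) ∷ u) x∉ with unshiftX u (λ x∈ → x∉ (there x∈))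
... | u' , refl = x i ∷ u' , refl
unshiftX (y j ∷ u) x∉ with unshiftX u (λ x∈ → x∉ (there x∈))
... | u' , refl = y j ∷ u' , refl

unshiftY : (u : Word m (suc n)) → y zero ∉ u → ∃ λ u' → shiftY u' ≡ u
unshiftY [] _ = [] , refl
unshiftY (y zero ∷ u) y∉ = ⊥-elim (y∉ (here refl))
unshiftY (y (suc j) ∷ u) y∉ with unshiftY u (λ y∈ → y∉ (there y∈))
... | u' , refl = y j ∷ u' , refl
unshiftY (x i ∷ u) y∉ with unshiftY u (λ y∈ → y∉ (there y∈))
... | u' , refl = x i ∷ u' , refl

unshiftXY : (u : Word (suc m) (suc n)) → x zero ∉ u → y zero ∉ u → ∃ λ u' → shiftXY u' ≡ u
unshiftXY [] _ _ = [] , refl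
unshiftXY (x zero ∷ u) x∉ _ = ⊥-elim (x∉ (here refl))
unshiftXY (y zero ∷ u) _ y∉ = ⊥-elim (y∉ (here refl))
unshiftXY (x (suc i) ∷ u) x∉ y∉ with unshiftXY u (λ x∈ → x∉ (there x∈)) (λ y∈ → y∉ (there y∈))
... | u' , refl = x i ∷ u' , refl
unshiftXY (y (suc j) ∷ u) x∉ y∉ with unshiftXY u (λ x∈ → x∉ (there x∈)) (λ y∈ → y∉ (there y∈))
... | u' , refl = y j ∷ u' , refl

Good : ℕ → Word m n → Set
Good a u = Shuffle u × HasAllX u × YsFollowedByX u × #y u ≡ a

prependX₀ : Word m n → Word (suc m) n
prependX₀ u = x zero ∷ shiftX u

prependY₀X₀ : Word m n → Word (suc m) (suc n)
prependY₀X₀ u = y zero ∷ x zero ∷ shiftXY u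

x₀-≺-shift : ∀ {u : Word m n} {z} → z ∈ shiftX u → x zero ≺ z
x₀-≺-shift z∈ with ∈-map⁻ _ z∈
... | x _ , _ , refl = s≤s z≤n
... | y _ , _ , refl = tt

x₀-≺-shiftXY : ∀ {u : Word m n} {z} → z ∈ shiftXY u → x zero ≺ z
x₀-≺-shiftXY z∈ with ∈-map⁻ _ z∈
... | x _ , _ , refl = s≤s z≤n
... | y _ , _ , refl = tt

y₀-≺-shiftXY : ∀ {u : Word m n} {z} → z ∈ shiftXY u → y zero ≺ z
y₀-≺-shiftXY z∈ with ∈-map⁻ _ z∈
... | x _ , _ , refl = tt
... | y _ , _ , refl = s≤s z≤n

good-prependX₀ : {u : Word m n} → Good a u → Good a (prependX₀ u)
good-prependX₀ {u = u} (sh , all-x , paired , #y≡) =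
  All.tabulate x₀-≺-shift ∷ ShiftX.Shuffle-relabel sh ,
  (λ { zero → here refl ; (suc i) → there (∈-map⁺ _ (all-x i)) }) ,
  ShiftX.YsFollowedByX-relabel u paired ,
  trans (ShiftX.#y-relabel u) #y≡

good-prependX₀⁻ : {u : Word m n} → Good a (prependX₀ u) → Good a u
good-prependX₀⁻ {u = u} (_ ∷ sh , all-x , paired , #y≡) =
  ShiftX.Shuffle-relabel⁻ sh ,
  (λ i → case all-x (suc i) of λ { (there x∈) → ShiftX.∈-relabel⁻ x∈ }) ,
  ShiftX.YsFollowedByX-relabel⁻ u paired ,
  trans (sym (ShiftX.#y-relabel u)) #y≡

good-prependY₀X₀ : {u : Word m n} → Good a u → Good (suc a) (prependY₀X₀ u)
good-prependY₀X₀ {u = u} (sh , all-x , paired , #y≡) =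
  (tt ∷ All.tabulate y₀-≺-shiftXY) ∷ All.tabulate x₀-≺-shiftXY ∷ ShiftXY.Shuffle-relabel sh ,
  (λ { zero → there (here refl) ; (suc i) → there (there (∈-map⁺ _ (all-x i))) }) ,
  ShiftXY.YsFollowedByX-relabel u paired ,
  cong suc (trans (ShiftXY.#y-relabel u) #y≡)

good-prependY₀X₀⁻ : {u : Word m n} → Good (suc a) (prependY₀X₀ u) → Good a u
good-prependY₀X₀⁻ {u = u} (_ ∷ _ ∷ sh , all-x , paired , #y≡) =
  ShiftXY.Shuffle-relabel⁻ sh ,
  (λ i → case all-x (suc i) of λ { (there (there x∈)) → ShiftXY.∈-relabel⁻ x∈ }) ,
  ShiftXY.YsFollowedByX-relabel⁻ u paired ,
  suc-injective (trans (cong suc (sym (ShiftXY.#y-relabel u))) #y≡)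

good-shiftY : {u : Word m n} → Good a u → Good a (shiftY u)
good-shiftY {u = u} (sh , all-x , paired , #y≡) =
  ShiftY.Shuffle-relabel sh , (λ i → ∈-map⁺ _ (all-x i)) ,
  ShiftY.YsFollowedByX-relabel u paired , trans (ShiftY.#y-relabel u) #y≡

good-shiftY⁻ : {u : Word m n} → Good a (shiftY u) → Good a u
good-shiftY⁻ {u = u} (sh , all-x , paired , #y≡) =
  ShiftY.Shuffle-relabel⁻ sh , (λ i → ShiftY.∈-relabel⁻ (all-x i)) ,
  ShiftY.YsFollowedByX-relabel⁻ u paired , trans (sym (ShiftY.#y-relabel u)) #y≡

good-split : {u : Word (suc m) n} → Good a u → StartsWithY u ⊎ Image prependX₀ (Good a) u
good-split {u = []} (_ , all-x , _) = case all-x zero of λ ()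
good-split {u = y j ∷ s} _ = inj₁ (j , s , refl)
good-split {u = x (suc i) ∷ s} (sh , all-x , _) with all-x zero
... | there x₀∈s = ⊥-elim (n≮0 (All.lookup (AllPairs.head sh) x₀∈s))
good-split {u = x zero ∷ s} g@(sh , _)
  with unshiftX s (λ x₀∈ → All.lookup (AllPairs.head (Shuffle⇒Unique sh)) x₀∈ refl)
... | u' , refl = inj₂ (u' , good-prependX₀⁻ g , refl)

good-startsWithY-split : {u : Word (suc m) (suc n)} → Good (suc a) u → StartsWithY u →
                         Image prependY₀X₀ (Good a) u
                         ⊎ Image shiftY (λ u' → Good (suc a) u' × StartsWithY u') u
good-startsWithY-split {u = y j ∷ x (suc i) ∷ s} (sh , all-x , _) _ with all-x zero
... | there (there x₀∈s) = ⊥-elim (n≮0 (All.lookup (AllPairs.head (AllPairs.tail sh)) x₀∈s))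
good-startsWithY-split {u = []} _ (_ , _ , ())
good-startsWithY-split {u = x _ ∷ _} _ (_ , _ , ())
good-startsWithY-split {u = y _ ∷ []} (_ , _ , () , _) _
good-startsWithY-split {u = y _ ∷ y _ ∷ _} (_ , _ , () , _) _
good-startsWithY-split {u = y zero ∷ x zero ∷ s} g@(sh , _) _
  with unshiftXY s (λ x₀∈ → All.lookup (AllPairs.head (AllPairs.tail (Shuffle⇒Unique sh))) x₀∈ refl)
                   (λ y₀∈ → All.lookup (AllPairs.head (Shuffle⇒Unique sh)) (there y₀∈) refl)
... | u' , refl = inj₁ (u' , good-prependY₀X₀⁻ g , refl)
good-startsWithY-split {u = u@(y (suc j) ∷ x zero ∷ s)} g@(sh , _) _ with unshiftY u y₀∉
  where
  y₀∉ : y zero ∉ u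
  y₀∉ (there y₀∈) = n≮0 (All.lookup (AllPairs.head sh) y₀∈)
... | y j′ ∷ w , e =
  inj₂ (y j′ ∷ w , (good-shiftY⁻ (subst (Good _) (sym e) g) , (j′ , w , refl)) , e)

wordScheme : CountingScheme Word
wordScheme = record
  { Counted = Good
  ; FirstMatched = StartsWithY
  ; addFreeX = prependX₀
  ; addPair = prependY₀X₀
  ; addFreeY = shiftY
  ; addFreeX-injective = λ e → ShiftX.relabelWord-injective (∷-injectiveʳ e)
  ; addPair-injective = λ e → ShiftXY.relabelWord-injective (∷-injectiveʳ (∷-injectiveʳ e))
  ; addFreeY-injective = ShiftY.relabelWord-injective
  ; addFreeX-counted = good-prependX₀
  ; addPair-counted = good-prependY₀X₀
  ; addFreeY-counted = good-shiftY
  ; addFreeX-unmatched = λ { _ (_ , _ , ()) }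
  ; addPair-matched = λ _ → zero , _ , refl
  ; addFreeY-matched = λ { (j , s , refl) → suc j , shiftY s , refl }
  ; addPair≢addFreeY = λ { _ (y _ ∷ _) () ; _ (x _ ∷ _) () ; _ [] () }
  ; counted-split = good-split
  ; matched-split = good-startsWithY-split
  ; counted-empty = Card-singleton [] ([] , (λ ()) , tt , refl)
                                    (λ u (_ , _ , paired , _) → paired⇒empty u paired)
  ; counted-empty-suc = λ u (_ , _ , paired , #y≡) →
      case trans (sym #y≡) (cong #y (paired⇒empty u paired)) of λ ()
  ; matched-size-zero = λ { (_ , _ , _ , ()) (_ , _ , refl) }
  ; matched-noY = λ { _ (() , _) }
  }
  where
  paired⇒empty : (u : Word 0 n) → YsFollowedByX u → u ≡ []
  paired⇒empty [] _ = refl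
  paired⇒empty (y _ ∷ y _ ∷ _) ()

good⇔noIndelCover : {u : Word m n} → Good a u ⇔ (IsShuffle u × InDeg u a × InDegIndel u 0)
good⇔noIndelCover = mk⇔
  (λ { (sh , all-x , paired , refl) →
         Shuffle⇒IsShuffle sh , good-inDeg sh all-x paired , good-inDegIndel all-x paired })
  (λ (is , inDeg , none) →
    let sh = IsShuffle⇒Shuffle is
        all-x , paired = noIndelCover⇒good sh none
    in sh , all-x , paired , Card-unique (good-inDeg sh all-x paired) inDeg)

proposition3p22 : (m n a : ℕ) →
    Card {EdgeSet m n} (λ σ → IsFaceΓ⁺ σ × size σ ≡ a) ((m C a) * (n C a))
    × Card {Word m n} (λ u → IsShuffle u × InDeg u a × InDegIndel u 0) ((m C a) * (n C a))
proposition3p22 m n a =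
  CountingSchemeCard.counted-card faceScheme m n a ,
  Card-resp (λ _ → Equivalence.to good⇔noIndelCover) (λ _ → Equivalence.from good⇔noIndelCover)
    (CountingSchemeCard.counted-card wordScheme m n a)
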